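{- For every integer $n\geq 1$, \[ A_n(0,-1)=\begin{cases}(-1)^{m}\dfrac{E_{n}}{2^{m}}, & n=2m+1,\\[6pt] (-1)^{m}\dfrac{E_{n+1}}{2^{m+1}}, & n=2m+2.\end{cases} \]
   Context: $\mathfrak{S}_n$ is the set of permutations of $[n]$. For $\pi=a_1\cdots a_n\in\mathfrak{S}_n$, an index $i\in[n-1]$ is a descent if $a_i>a_{i+1}$; $\mathrm{odes}(\pi)$ (resp. $\mathrm{edes}(\pi)$) is the number of descents at odd (resp. even) positions. $A_n(p,q)=\sum_{\pi\in\mathfrak{S}_n}p^{\mathrm{odes}(\pi)}q^{\mathrm{edes}(\pi)}$. The Euler number $E_n$ is the number of alternating permutations $a_1>a_2<a_3>\cdots$ in $\mathfrak{S}_n$; $\sum_{n\ge0}E_nt^n/n!=\tan t+\sec t$. -}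

module Defs where

open import Data.Nat as ℕ using (ℕ; zero; suc; _<ᵇ_)
open import Data.Bool using (Bool; true; false; if_then_else_; _∧_; not)
open import Data.List using (List; []; _∷_; map; concatMap; filter; length; upTo)
open import Data.List.Relation.Unary.Unique.Propositional using (Unique)
open import Data.List.Relation.Unary.AllPairs using (allPairs?)
open import Data.Integer as ℤ using (ℤ)
import Data.Nat.Properties as ℕP
open import Relation.Nullary.Decidable using (¬?)

words : ℕ → ℕ → List (List ℕ)
words n zero    = [] ∷ []
words n (suc k) = concatMap (λ a → map (a ∷_) (words n k)) (map suc (upTo n))

-- 𝔖ₙ : the permutations of [n] in one-line notation a₁⋯aₙ,
-- i.e. the words of length n over [n] with pairwise distinct letters
perms : ℕ → List (List ℕ)
perms n = filter (allPairs? (λ x y → ¬? (x ℕ.≟ y))) (words n n)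

-- descent set (1-indexed positions i with aᵢ > aᵢ₊₁), starting at position i
descentsFrom : ℕ → List ℕ → List ℕ
descentsFrom i []           = []
descentsFrom i (a ∷ [])     = []
descentsFrom i (a ∷ b ∷ w)  =
  if b <ᵇ a then i ∷ descentsFrom (suc i) (b ∷ w) else descentsFrom (suc i) (b ∷ w)

descents : List ℕ → List ℕ
descents = descentsFrom 1

isEven : ℕ → Bool
isEven zero          = true
isEven (suc zero)    = false
isEven (suc (suc n)) = isEven n

odes : List ℕ → ℕ
odes π = length (filter (λ i → ¬? (Data.Bool._≟_ (isEven i) true)) (descents π))
  where import Data.Bool

edes : List ℕ → ℕ
edes π = length (filter (λ i → Data.Bool._≟_ (isEven i) true) (descents π))
  where import Data.Bool

sumℤ : List ℤ → ℤ
sumℤ []       = ℤ.0ℤ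
sumℤ (x ∷ xs) = x ℤ.+ sumℤ xs

-- Aₙ(p,q) = Σ_{π ∈ 𝔖ₙ} p^{odes π} q^{edes π}, evaluated at integers p, q (0^0 = 1)
A : ℕ → ℤ → ℤ → ℤ
A n p q = sumℤ (map (λ π → (p ℤ.^ odes π) ℤ.* (q ℤ.^ edes π)) (perms n))

-- alternating: a₁ > a₂ < a₃ > ⋯ ; position i (1-indexed) odd ⇒ aᵢ > aᵢ₊₁, even ⇒ aᵢ < aᵢ₊₁
altFrom : ℕ → List ℕ → Bool
altFrom i []          = true
altFrom i (a ∷ [])    = true
altFrom i (a ∷ b ∷ w) =
  (if isEven i then a <ᵇ b else b <ᵇ a) ∧ altFrom (suc i) (b ∷ w)

alternating : List ℕ → Bool
alternating = altFrom 1

E : ℕ → ℕ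
E n = length (filter (λ π → Data.Bool._≟_ (alternating π) true) (perms n))
  where import Data.Bool

module Submission where

-- Both A_n(0,-1) = Σ_π 0^odes(π) (-1)^edes(π) and E_n are sums over 𝔖ₙ of a
-- product of local factors, one for each adjacent pair, depending only on the
-- parity of its position and on whether it is a descent.  Removing the first
-- letter turns any such count into a boustrophedon recursion (Transfer), and
-- expanding its rows in the binomial basis yields identities of exponential
-- generating functions (Instances): with a(n) = A_n(0,-1) and e(n) = E_n,
--     cosh² (t/√2) · a(t) = cosh (√2 t) + sinh (√2 t)/√2,      cos t · e(t) = 1 + sin t.
-- The substitution t ↦ √-2 t turns the first identity into one about cos² t;
-- comparing it with cos² t · e(t) and cos² t · e′(t) coefficientwise and
-- cancelling cos² t (Comparison) gives
--     2ᵐ a(2m+1) = (-1)ᵐ e(2m+1)   and   2ᵐ⁺¹ a(2m+2) = (-1)ᵐ e(2m+3),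
-- which is the theorem after moving to ℚ (Conversions).

module Parity where
  open import Data.Nat using (ℕ; zero; suc; _+_; _*_; ⌊_/2⌋)
  import Data.Nat.Properties as ℕP
  open import Data.Product using (Σ-syntax; _,_)
  open import Data.Sum using (_⊎_; inj₁; inj₂)
  open import Function using (_∘_)
  open import Relation.Binary.PropositionalEquality

  -- double q = 2q, by a recursion that steps two at a time, so that parity
  -- arguments can proceed by induction on q
  double : ℕ → ℕ
  double zero    = zero
  double (suc q) = suc (suc (double q))

  double≡2* : ∀ q → 2 * q ≡ double q
  double≡2* zero    = refl
  double≡2* (suc q) = cong suc (trans (ℕP.+-suc q (q + 0)) (cong suc (double≡2* q)))

  ⌊double/2⌋ : ∀ q → ⌊ double q /2⌋ ≡ q
  ⌊double/2⌋ zero    = refl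
  ⌊double/2⌋ (suc q) = cong suc (⌊double/2⌋ q)

  ⌊odd/2⌋ : ∀ q → ⌊ suc (double q) /2⌋ ≡ q
  ⌊odd/2⌋ zero    = refl
  ⌊odd/2⌋ (suc q) = cong suc (⌊odd/2⌋ q)

  parity : ∀ k → Σ[ q ∈ ℕ ] (k ≡ double q ⊎ k ≡ suc (double q))
  parity zero          = zero , inj₁ refl
  parity (suc zero)    = zero , inj₂ refl
  parity (suc (suc k)) with parity k
  ... | q , inj₁ e = suc q , inj₁ (cong (suc ∘ suc) e)
  ... | q , inj₂ e = suc q , inj₂ (cong (suc ∘ suc) e)


module Series where
  open import Data.Nat as ℕ using (ℕ; zero; suc; _∸_; _<_; _≤_; z≤n; s≤s; ⌊_/2⌋; _<ᵇ_)
  open import Data.Bool using (if_then_else_)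
  import Data.Nat.Properties as ℕP
  open import Data.Nat.Induction using (<-rec)
  open import Data.Integer as ℤ using (ℤ; _+_; _*_; _^_; 0ℤ; 1ℤ; -1ℤ)
  import Data.Integer.Properties as ℤP
  open import Data.Integer.Tactic.RingSolver using (solve-∀)
  open import Algebra.Bundles using (AbelianGroup)
  open import Algebra.Properties.Group (AbelianGroup.group ℤP.+-0-abelianGroup)
    using (∙-cancelˡ)
  open import Algebra.Properties.CommutativeSemigroup ℤP.+-commutativeSemigroup using (interchange)
  open import Data.Product using (_,_)
  open import Data.Sum using (inj₁; inj₂)
  open import Function using (_∘_)
  open import Relation.Binary.PropositionalEquality
  open Parity

  -- An integer sequence, read as the coefficients of an exponential
  -- generating function  Σ f n tⁿ/n!.
  Seq : Set
  Seq = ℕ → ℤ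

  ∑ : ℕ → Seq → ℤ
  ∑ zero    f = 0ℤ
  ∑ (suc n) f = f 0 + ∑ n (f ∘ suc)

  ∑-cong : ∀ n {f g : Seq} → (∀ k → k < n → f k ≡ g k) → ∑ n f ≡ ∑ n g
  ∑-cong zero    h = refl
  ∑-cong (suc n) h = cong₂ _+_ (h 0 (s≤s z≤n)) (∑-cong n (λ k k<n → h (suc k) (s≤s k<n)))

  ∑-zero : ∀ n → ∑ n (λ _ → 0ℤ) ≡ 0ℤ
  ∑-zero zero    = refl
  ∑-zero (suc n) = trans (ℤP.+-identityˡ _) (∑-zero n)

  ∑-+ : ∀ n (f g : Seq) → ∑ n (λ k → f k + g k) ≡ ∑ n f + ∑ n g
  ∑-+ zero    f g = refl
  ∑-+ (suc n) f g = trans (cong ((f 0 + g 0) +_) (∑-+ n (f ∘ suc) (g ∘ suc)))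
                          (interchange (f 0) (g 0) (∑ n (f ∘ suc)) (∑ n (g ∘ suc)))

  ∑-* : ∀ n (c : ℤ) (f : Seq) → ∑ n (λ k → c * f k) ≡ c * ∑ n f
  ∑-* zero    c f = sym (ℤP.*-zeroʳ c)
  ∑-* (suc n) c f = trans (cong (c * f 0 +_) (∑-* n c (f ∘ suc)))
                          (sym (ℤP.*-distribˡ-+ c (f 0) (∑ n (f ∘ suc))))

  ∑-last : ∀ n (f : Seq) → ∑ (suc n) f ≡ ∑ n f + f n
  ∑-last zero    f = trans (ℤP.+-identityʳ (f 0)) (sym (ℤP.+-identityˡ (f 0)))
  ∑-last (suc n) f = trans (cong (f 0 +_) (∑-last n (f ∘ suc)))
                           (sym (ℤP.+-assoc (f 0) (∑ n (f ∘ suc)) (f (suc n))))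

  ∑-swap : ∀ m k (F : ℕ → ℕ → ℤ) → ∑ m (λ c → ∑ k (F c)) ≡ ∑ k (λ j → ∑ m (λ c → F c j))
  ∑-swap zero    k F = sym (∑-zero k)
  ∑-swap (suc m) k F = trans (cong (∑ k (F 0) +_) (∑-swap m k (F ∘ suc)))
                             (sym (∑-+ k (F 0) (λ j → ∑ m (λ c → F (suc c) j))))

  ∑-truncate : ∀ m i (f : Seq) → i ≤ m → ∑ m (λ c → if c <ᵇ i then f c else 0ℤ) ≡ ∑ i f
  ∑-truncate m       zero    f _         = ∑-zero m
  ∑-truncate (suc m) (suc i) f (s≤s i≤m) = cong (f 0 +_) (∑-truncate m i (f ∘ suc) i≤m)

  ∑-reverse : ∀ n (f : Seq) → ∑ (suc n) f ≡ ∑ (suc n) (λ i → f (n ∸ i))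
  ∑-reverse zero    f = refl
  ∑-reverse (suc n) f = begin
      f 0 + ∑ (suc n) (f ∘ suc)
    ≡⟨ cong (f 0 +_) (∑-reverse n (f ∘ suc)) ⟩
      f 0 + ∑ (suc n) (λ i → f (suc (n ∸ i)))
    ≡⟨ cong (f 0 +_) (∑-cong (suc n) (λ i i≤n → cong f (sym (ℕP.+-∸-assoc 1 (ℕP.≤-pred i≤n))))) ⟩
      f 0 + ∑ (suc n) (λ i → f (suc n ∸ i))
    ≡⟨ ℤP.+-comm (f 0) _ ⟩
      ∑ (suc n) (λ i → f (suc n ∸ i)) + f 0
    ≡⟨ cong (λ k → ∑ (suc n) (λ i → f (suc n ∸ i)) + f k) (sym (ℕP.n∸n≡0 n)) ⟩
      ∑ (suc n) (λ i → f (suc n ∸ i)) + f (suc n ∸ suc n)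
    ≡⟨ sym (∑-last (suc n) (λ i → f (suc n ∸ i))) ⟩
      ∑ (suc (suc n)) (λ i → f (suc n ∸ i))
    ∎ where open ≡-Reasoning

  binom : ℕ → ℕ → ℤ
  binom n       zero    = 1ℤ
  binom zero    (suc k) = 0ℤ
  binom (suc n) (suc k) = binom n k + binom n (suc k)

  binom-above : ∀ {n k} → n < k → binom n k ≡ 0ℤ
  binom-above {zero}  {suc k} _       = refl
  binom-above {suc n} {suc k} (s≤s p) = cong₂ _+_ (binom-above p) (binom-above (ℕP.m<n⇒m<1+n p))

  binom-diag : ∀ n → binom n n ≡ 1ℤ
  binom-diag zero    = refl
  binom-diag (suc n) = trans (cong₂ _+_ (binom-diag n) (binom-above (ℕP.n<1+n n))) (ℤP.+-identityʳ 1ℤ)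

  hockey-stick : ∀ i j → ∑ i (λ c → binom c j) ≡ binom i (suc j)
  hockey-stick zero    j = refl
  hockey-stick (suc i) j = trans (∑-last i (λ c → binom c j))
    (trans (cong (_+ binom i j) (hockey-stick i j)) (ℤP.+-comm (binom i (suc j)) (binom i j)))

  ∑-binomial-basis : ∀ i m (a f : Seq) → (∀ c → c < i → f c ≡ ∑ m (λ j → a j * binom c j)) →
                     ∑ i f ≡ ∑ m (λ j → a j * binom i (suc j))
  ∑-binomial-basis i m a f f≡ = begin
      ∑ i f                                          ≡⟨ ∑-cong i f≡ ⟩
      ∑ i (λ c → ∑ m (λ j → a j * binom c j))        ≡⟨ ∑-swap i m (λ c j → a j * binom c j) ⟩
      ∑ m (λ j → ∑ i (λ c → a j * binom c j))        ≡⟨ ∑-cong m (λ j _ → ∑-* i (a j) (λ c → binom c j)) ⟩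
      ∑ m (λ j → a j * ∑ i (λ c → binom c j))        ≡⟨ ∑-cong m (λ j _ → cong (a j *_) (hockey-stick i j)) ⟩
      ∑ m (λ j → a j * binom i (suc j))              ∎
    where open ≡-Reasoning

  -- the shift, i.e. the coefficient sequence of the derivative
  ∂ : Seq → Seq
  ∂ f k = f (suc k)

  -- the product of exponential generating functions, defined by the
  -- Leibniz rule  ∂ (f g) = ∂f g + f ∂g
  infixl 7 _⊛_
  _⊛_ : Seq → Seq → Seq
  (f ⊛ g) zero    = f 0 * g 0
  (f ⊛ g) (suc n) = (∂ f ⊛ g) n + (f ⊛ ∂ g) n

  infixl 6 _⊕_
  _⊕_ : Seq → Seq → Seq
  (f ⊕ g) k = f k + g k

  infixr 8 _·_
  _·_ : ℤ → Seq → Seq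
  (c · f) k = c * f k

  one : Seq
  one zero    = 1ℤ
  one (suc k) = 0ℤ

  ⊛-cong : ∀ {f f′ g g′} → f ≗ f′ → g ≗ g′ → f ⊛ g ≗ f′ ⊛ g′
  ⊛-cong hf hg zero    = cong₂ _*_ (hf 0) (hg 0)
  ⊛-cong hf hg (suc n) = cong₂ _+_ (⊛-cong (hf ∘ suc) hg n) (⊛-cong hf (hg ∘ suc) n)

  ⊛-comm : ∀ f g → f ⊛ g ≗ g ⊛ f
  ⊛-comm f g zero    = ℤP.*-comm (f 0) (g 0)
  ⊛-comm f g (suc n) = trans (cong₂ _+_ (⊛-comm (∂ f) g n) (⊛-comm f (∂ g) n))
                             (ℤP.+-comm ((g ⊛ ∂ f) n) ((∂ g ⊛ f) n))

  ⊛-distribˡ : ∀ f g h → f ⊛ (g ⊕ h) ≗ f ⊛ g ⊕ f ⊛ h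
  ⊛-distribˡ f g h zero    = ℤP.*-distribˡ-+ (f 0) (g 0) (h 0)
  ⊛-distribˡ f g h (suc n) =
    trans (cong₂ _+_ (⊛-distribˡ (∂ f) g h n) (⊛-distribˡ f (∂ g) (∂ h) n))
          (interchange ((∂ f ⊛ g) n) ((∂ f ⊛ h) n) ((f ⊛ ∂ g) n) ((f ⊛ ∂ h) n))

  ⊛-distribʳ : ∀ f g h → (g ⊕ h) ⊛ f ≗ g ⊛ f ⊕ h ⊛ f
  ⊛-distribʳ f g h n = trans (⊛-comm (g ⊕ h) f n)
    (trans (⊛-distribˡ f g h n) (cong₂ _+_ (⊛-comm f g n) (⊛-comm f h n)))

  ⊛-scalarˡ : ∀ c f g → (c · f) ⊛ g ≗ c · (f ⊛ g)
  ⊛-scalarˡ c f g zero    = ℤP.*-assoc c (f 0) (g 0)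
  ⊛-scalarˡ c f g (suc n) = trans (cong₂ _+_ (⊛-scalarˡ c (∂ f) g n) (⊛-scalarˡ c f (∂ g) n))
                                  (sym (ℤP.*-distribˡ-+ c ((∂ f ⊛ g) n) ((f ⊛ ∂ g) n)))

  ⊛-scalarʳ : ∀ c f g → f ⊛ (c · g) ≗ c · (f ⊛ g)
  ⊛-scalarʳ c f g n = trans (⊛-comm f (c · g) n)
    (trans (⊛-scalarˡ c g f n) (cong (c *_) (⊛-comm g f n)))

  ⊛-assoc : ∀ f g h → (f ⊛ g) ⊛ h ≗ f ⊛ (g ⊛ h)
  ⊛-assoc f g h zero    = ℤP.*-assoc (f 0) (g 0) (h 0)
  ⊛-assoc f g h (suc n) = begin
      (∂ (f ⊛ g) ⊛ h) n + ((f ⊛ g) ⊛ ∂ h) n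
    ≡⟨ cong (_+ ((f ⊛ g) ⊛ ∂ h) n) (⊛-distribʳ h (∂ f ⊛ g) (f ⊛ ∂ g) n) ⟩
      ((∂ f ⊛ g) ⊛ h) n + ((f ⊛ ∂ g) ⊛ h) n + ((f ⊛ g) ⊛ ∂ h) n
    ≡⟨ cong₂ _+_ (cong₂ _+_ (⊛-assoc (∂ f) g h n) (⊛-assoc f (∂ g) h n)) (⊛-assoc f g (∂ h) n) ⟩
      (∂ f ⊛ (g ⊛ h)) n + (f ⊛ (∂ g ⊛ h)) n + (f ⊛ (g ⊛ ∂ h)) n
    ≡⟨ ℤP.+-assoc ((∂ f ⊛ (g ⊛ h)) n) ((f ⊛ (∂ g ⊛ h)) n) ((f ⊛ (g ⊛ ∂ h)) n) ⟩
      (∂ f ⊛ (g ⊛ h)) n + ((f ⊛ (∂ g ⊛ h)) n + (f ⊛ (g ⊛ ∂ h)) n)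
    ≡⟨ cong ((∂ f ⊛ (g ⊛ h)) n +_) (sym (⊛-distribˡ f (∂ g ⊛ h) (g ⊛ ∂ h) n)) ⟩
      (∂ f ⊛ (g ⊛ h)) n + (f ⊛ ∂ (g ⊛ h)) n
    ∎ where open ≡-Reasoning

  ⊛-zeroʳ : ∀ f → f ⊛ (λ _ → 0ℤ) ≗ (λ _ → 0ℤ)
  ⊛-zeroʳ f zero    = ℤP.*-zeroʳ (f 0)
  ⊛-zeroʳ f (suc n) = cong₂ _+_ (⊛-zeroʳ (∂ f) n) (⊛-zeroʳ f n)

  ⊛-identityʳ : ∀ f → f ⊛ one ≗ f
  ⊛-identityʳ f zero    = ℤP.*-identityʳ (f 0)
  ⊛-identityʳ f (suc n) = trans (cong₂ _+_ (⊛-identityʳ (∂ f) n) (⊛-zeroʳ f n)) (ℤP.+-identityʳ (f (suc n)))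

  ⊛-binomial : ∀ f g n → (f ⊛ g) n ≡ ∑ (suc n) (λ k → binom n k * (f k * g (n ∸ k)))
  ⊛-binomial f g zero    = sym (trans (ℤP.+-identityʳ _) (ℤP.*-identityˡ _))
  ⊛-binomial f g (suc n) = begin
      (∂ f ⊛ g) n + (f ⊛ ∂ g) n
    ≡⟨ cong₂ _+_ (⊛-binomial (∂ f) g n) (⊛-binomial f (∂ g) n) ⟩
      ∑ (suc n) left + (head + ∑ n (λ k → binom n (suc k) * (f (suc k) * g (suc (n ∸ suc k)))))
    ≡⟨ cong (λ t → ∑ (suc n) left + (head + t)) right-reindexed ⟩
      ∑ (suc n) left + (head + ∑ (suc n) right)
    ≡⟨ regroup (∑ (suc n) left) head (∑ (suc n) right) ⟩
      head + (∑ (suc n) left + ∑ (suc n) right)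
    ≡⟨ cong (head +_) (sym (∑-+ (suc n) left right)) ⟩
      head + ∑ (suc n) (λ k → left k + right k)
    ≡⟨ cong (head +_) (∑-cong (suc n) {g = λ k → (binom n k + binom n (suc k)) * (f (suc k) * g (n ∸ k))}
                                       (λ k _ → sym (ℤP.*-distribʳ-+ _ (binom n k) (binom n (suc k))))) ⟩
      ∑ (suc (suc n)) (λ k → binom (suc n) k * (f k * g (suc n ∸ k)))
    ∎
    where
    open ≡-Reasoning
    head  = 1ℤ * (f 0 * g (suc n))
    left  = λ k → binom n k * (f (suc k) * g (n ∸ k))
    right = λ k → binom n (suc k) * (f (suc k) * g (n ∸ k))
    regroup : ∀ x p q → x + (p + q) ≡ p + (x + q)
    regroup = solve-∀
    -- the last term of the reindexed right-hand sum vanishes since C(n, n+1) = 0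
    right-reindexed : ∑ n (λ k → binom n (suc k) * (f (suc k) * g (suc (n ∸ suc k)))) ≡ ∑ (suc n) right
    right-reindexed = begin
        ∑ n (λ k → binom n (suc k) * (f (suc k) * g (suc (n ∸ suc k))))
      ≡⟨ ∑-cong n (λ k k<n → cong (λ t → binom n (suc k) * (f (suc k) * g t)) (sym (ℕP.+-∸-assoc 1 k<n))) ⟩
        ∑ n right
      ≡⟨ sym (ℤP.+-identityʳ _) ⟩
        ∑ n right + 0ℤ
      ≡⟨ cong (∑ n right +_) (sym (cong (_* (f (suc n) * g (n ∸ n))) (binom-above (ℕP.n<1+n n)))) ⟩
        ∑ n right + right n
      ≡⟨ sym (∑-last n right) ⟩
        ∑ (suc n) right
      ∎

  ⊛-last : ∀ f g n → (f ⊛ g) n ≡ ∑ n (λ k → binom n k * (f k * g (n ∸ k))) + f n * g 0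
  ⊛-last f g n = begin
      (f ⊛ g) n
    ≡⟨ ⊛-binomial f g n ⟩
      ∑ (suc n) (λ k → binom n k * (f k * g (n ∸ k)))
    ≡⟨ ∑-last n _ ⟩
      ∑ n (λ k → binom n k * (f k * g (n ∸ k))) + binom n n * (f n * g (n ∸ n))
    ≡⟨ cong (∑ n (λ k → binom n k * (f k * g (n ∸ k))) +_)
         (trans (cong₂ (λ c m → c * (f n * g m)) (binom-diag n) (ℕP.n∸n≡0 n)) (ℤP.*-identityˡ _)) ⟩
      ∑ n (λ k → binom n k * (f k * g (n ∸ k))) + f n * g 0
    ∎ where open ≡-Reasoning

  -- a series with constant term 1 is cancellable:  K x = K y  implies  x = y.
  -- By strong induction: the n-th coefficients of K x and K y differ only in x n, y n.
  ⊛-cancelˡ : ∀ K x y → K 0 ≡ 1ℤ → K ⊛ x ≗ K ⊛ y → x ≗ y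
  ⊛-cancelˡ K x y K0≡1 Kx≡Ky = <-rec (λ n → x n ≡ y n) step
    where
    step : ∀ n → (∀ {m} → m < n → x m ≡ y m) → x n ≡ y n
    step n IH = ∙-cancelˡ (lower x) (x n) (y n) (begin
        lower x + x n
      ≡⟨ cong (lower x +_) (sym (trans (cong (x n *_) K0≡1) (ℤP.*-identityʳ (x n)))) ⟩
        lower x + x n * K 0
      ≡⟨ sym (⊛-last x K n) ⟩
        (x ⊛ K) n
      ≡⟨ trans (⊛-comm x K n) (trans (Kx≡Ky n) (⊛-comm K y n)) ⟩
        (y ⊛ K) n
      ≡⟨ ⊛-last y K n ⟩
        lower y + y n * K 0
      ≡⟨ cong₂ _+_ (∑-cong n (λ k k<n → cong (λ t → binom n k * (t * K (n ∸ k))) (sym (IH k<n))))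
                   (trans (cong (y n *_) K0≡1) (ℤP.*-identityʳ (y n))) ⟩
        lower x + y n
      ∎)
      where
      open ≡-Reasoning
      lower : Seq → ℤ
      lower z = ∑ n (λ k → binom n k * (z k * K (n ∸ k)))

  -- substitution t ↦ c t multiplies the n-th coefficient by cⁿ; it is multiplicative
  scale : ℤ → Seq → Seq
  scale c f k = c ^ k * f k

  ⊛-scale : ∀ c f g → scale c f ⊛ scale c g ≗ scale c (f ⊛ g)
  ⊛-scale c f g zero    = trans (cong₂ _*_ (ℤP.*-identityˡ (f 0)) (ℤP.*-identityˡ (g 0)))
                                (sym (ℤP.*-identityˡ _))
  ⊛-scale c f g (suc n) = begin
      (∂ (scale c f) ⊛ scale c g) n + (scale c f ⊛ ∂ (scale c g)) n
    ≡⟨ cong₂ _+_ (⊛-cong (λ k → shift-scale f k) (λ _ → refl) n) (⊛-cong (λ _ → refl) (λ k → shift-scale g k) n) ⟩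
      ((c · scale c (∂ f)) ⊛ scale c g) n + (scale c f ⊛ (c · scale c (∂ g))) n
    ≡⟨ cong₂ _+_ (⊛-scalarˡ c (scale c (∂ f)) (scale c g) n) (⊛-scalarʳ c (scale c f) (scale c (∂ g)) n) ⟩
      c * (scale c (∂ f) ⊛ scale c g) n + c * (scale c f ⊛ scale c (∂ g)) n
    ≡⟨ cong₂ (λ u v → c * u + c * v) (⊛-scale c (∂ f) g n) (⊛-scale c f (∂ g) n) ⟩
      c * (c ^ n * (∂ f ⊛ g) n) + c * (c ^ n * (f ⊛ ∂ g) n)
    ≡⟨ collect c (c ^ n) ((∂ f ⊛ g) n) ((f ⊛ ∂ g) n) ⟩
      scale c (f ⊛ g) (suc n)
    ∎
    where
    open ≡-Reasoning
    shift-scale : ∀ h k → ∂ (scale c h) k ≡ (c · scale c (∂ h)) k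
    shift-scale h k = ℤP.*-assoc c (c ^ k) (h (suc k))
    collect : ∀ c p u v → c * (p * u) + c * (p * v) ≡ (c * p) * (u + v)
    collect = solve-∀

  Even : Seq → Set
  Even f = ∀ q → f (suc (double q)) ≡ 0ℤ

  -- substitution t ↦ √c t, written without square roots for products with an
  -- even series: the n-th coefficient is multiplied by c ^ ⌊n/2⌋
  halfScale : ℤ → Seq → Seq
  halfScale c f k = c ^ ⌊ k /2⌋ * f k

  ⌊double+/2⌋ : ∀ q j → ⌊ double q ℕ.+ j /2⌋ ≡ ⌊ double q /2⌋ ℕ.+ ⌊ j /2⌋
  ⌊double+/2⌋ zero    j = refl
  ⌊double+/2⌋ (suc q) j = cong suc (⌊double+/2⌋ q j)

  ⊛-halfScale : ∀ c K x → Even K → halfScale c K ⊛ halfScale c x ≗ halfScale c (K ⊛ x)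
  ⊛-halfScale c K x K-even n = begin
      (halfScale c K ⊛ halfScale c x) n
    ≡⟨ ⊛-binomial (halfScale c K) (halfScale c x) n ⟩
      ∑ (suc n) (λ k → binom n k * (halfScale c K k * halfScale c x (n ∸ k)))
    ≡⟨ ∑-cong (suc n) (λ k k≤n → term k (ℕP.m+[n∸m]≡n (ℕP.≤-pred k≤n))) ⟩
      ∑ (suc n) (λ k → c ^ ⌊ n /2⌋ * (binom n k * (K k * x (n ∸ k))))
    ≡⟨ ∑-* (suc n) (c ^ ⌊ n /2⌋) (λ k → binom n k * (K k * x (n ∸ k))) ⟩
      c ^ ⌊ n /2⌋ * ∑ (suc n) (λ k → binom n k * (K k * x (n ∸ k)))
    ≡⟨ cong (c ^ ⌊ n /2⌋ *_) (sym (⊛-binomial K x n)) ⟩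
      halfScale c (K ⊛ x) n
    ∎
    where
    open ≡-Reasoning
    rearrange : ∀ b p q u v → b * ((p * u) * (q * v)) ≡ (p * q) * (b * (u * v))
    rearrange = solve-∀
    vanish : ∀ b p q v r → b * ((p * 0ℤ) * (q * v)) ≡ r * (b * (0ℤ * v))
    vanish = solve-∀
    -- only even k contribute, and for those ⌊k/2⌋ + ⌊(n-k)/2⌋ = ⌊n/2⌋
    term : ∀ k → k ℕ.+ (n ∸ k) ≡ n →
           binom n k * (halfScale c K k * halfScale c x (n ∸ k))
           ≡ c ^ ⌊ n /2⌋ * (binom n k * (K k * x (n ∸ k)))
    term k k+j≡n with parity k
    ... | q , inj₂ refl rewrite K-even q = vanish (binom n k) (c ^ ⌊ k /2⌋) (c ^ ⌊ n ∸ k /2⌋) (x (n ∸ k)) (c ^ ⌊ n /2⌋)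
    ... | q , inj₁ refl = begin
        binom n k * ((c ^ ⌊ k /2⌋ * K k) * (c ^ ⌊ n ∸ k /2⌋ * x (n ∸ k)))
      ≡⟨ rearrange (binom n k) (c ^ ⌊ k /2⌋) (c ^ ⌊ n ∸ k /2⌋) (K k) (x (n ∸ k)) ⟩
        (c ^ ⌊ k /2⌋ * c ^ ⌊ n ∸ k /2⌋) * (binom n k * (K k * x (n ∸ k)))
      ≡⟨ cong (_* (binom n k * (K k * x (n ∸ k)))) (begin
           c ^ ⌊ k /2⌋ * c ^ ⌊ n ∸ k /2⌋   ≡⟨ sym (ℤP.^-distribˡ-+-* c ⌊ k /2⌋ _) ⟩
           c ^ (⌊ k /2⌋ ℕ.+ ⌊ n ∸ k /2⌋)   ≡⟨ cong (c ^_) (sym (⌊double+/2⌋ q (n ∸ k))) ⟩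
           c ^ ⌊ k ℕ.+ (n ∸ k) /2⌋         ≡⟨ cong (λ m → c ^ ⌊ m /2⌋) k+j≡n ⟩
           c ^ ⌊ n /2⌋                      ∎) ⟩
        c ^ ⌊ n /2⌋ * (binom n k * (K k * x (n ∸ k)))
      ∎

  -1^double : ∀ q → -1ℤ ^ double q ≡ 1ℤ
  -1^double zero    = refl
  -1^double (suc q) = trans (square-neg (-1ℤ ^ double q)) (-1^double q)
    where
    square-neg : ∀ x → -1ℤ * (-1ℤ * x) ≡ x
    square-neg = solve-∀

  -1^odd : ∀ q → -1ℤ ^ suc (double q) ≡ -1ℤ
  -1^odd q = cong (-1ℤ *_) (-1^double q)

  ⊛-reflect : ∀ K g → Even K → K ⊛ scale -1ℤ g ≗ scale -1ℤ (K ⊛ g)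
  ⊛-reflect K g K-even n = trans (⊛-cong K-reflected (λ _ → refl) n) (⊛-scale -1ℤ K g n)
    where
    K-reflected : K ≗ scale -1ℤ K
    K-reflected k with parity k
    ... | q , inj₁ refl = sym (trans (cong (_* K k) (-1^double q)) (ℤP.*-identityˡ (K k)))
    ... | q , inj₂ refl = trans (K-even q) (sym (trans (cong (-1ℤ ^ k *_) (K-even q)) (ℤP.*-zeroʳ (-1ℤ ^ k))))


module Trig where
  open import Data.Nat using (zero; suc)
  open import Data.Integer as ℤ using (_+_; _*_; _^_; 0ℤ; 1ℤ; -1ℤ)
  open import Data.Integer.Tactic.RingSolver using (solve-∀)
  open import Relation.Binary.PropositionalEquality
  open Parity
  open Series

  cosᶜ sinᶜ : Seq
  cosᶜ zero          = 1ℤ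
  cosᶜ (suc zero)    = 0ℤ
  cosᶜ (suc (suc n)) = -1ℤ * cosᶜ n
  sinᶜ zero          = 0ℤ
  sinᶜ (suc zero)    = 1ℤ
  sinᶜ (suc (suc n)) = -1ℤ * sinᶜ n

  ∂cos : ∂ cosᶜ ≗ -1ℤ · sinᶜ
  ∂cos zero          = refl
  ∂cos (suc zero)    = refl
  ∂cos (suc (suc k)) = cong (-1ℤ *_) (∂cos k)

  ∂sin : ∂ sinᶜ ≗ cosᶜ
  ∂sin zero          = refl
  ∂sin (suc zero)    = refl
  ∂sin (suc (suc k)) = cong (-1ℤ *_) (∂sin k)

  cos-even : ∀ q → cosᶜ (double q) ≡ -1ℤ ^ q
  cos-even zero    = refl
  cos-even (suc q) = cong (-1ℤ *_) (cos-even q)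

  cos-odd : Even cosᶜ
  cos-odd zero    = refl
  cos-odd (suc q) = cong (-1ℤ *_) (cos-odd q)

  sin-even : ∀ q → sinᶜ (double q) ≡ 0ℤ
  sin-even zero    = refl
  sin-even (suc q) = cong (-1ℤ *_) (sin-even q)

  sin-odd : ∀ q → sinᶜ (suc (double q)) ≡ -1ℤ ^ q
  sin-odd zero    = refl
  sin-odd (suc q) = cong (-1ℤ *_) (sin-odd q)

  cc cs ss : Seq
  cc = cosᶜ ⊛ cosᶜ
  cs = cosᶜ ⊛ sinᶜ
  ss = sinᶜ ⊛ sinᶜ

  ∂cc : ∀ n → cc (suc n) ≡ ℤ.-[1+ 1 ] * cs n
  ∂cc n = begin
      (∂ cosᶜ ⊛ cosᶜ) n + (cosᶜ ⊛ ∂ cosᶜ) n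
    ≡⟨ cong₂ _+_ (⊛-cong ∂cos (λ _ → refl) n) (⊛-cong (λ _ → refl) ∂cos n) ⟩
      ((-1ℤ · sinᶜ) ⊛ cosᶜ) n + (cosᶜ ⊛ (-1ℤ · sinᶜ)) n
    ≡⟨ cong₂ _+_ (trans (⊛-scalarˡ -1ℤ sinᶜ cosᶜ n) (cong (-1ℤ *_) (⊛-comm sinᶜ cosᶜ n)))
                 (⊛-scalarʳ -1ℤ cosᶜ sinᶜ n) ⟩
      -1ℤ * cs n + -1ℤ * cs n
    ≡⟨ double-neg (cs n) ⟩
      ℤ.-[1+ 1 ] * cs n
    ∎
    where
    open ≡-Reasoning
    double-neg : ∀ x → -1ℤ * x + -1ℤ * x ≡ ℤ.-[1+ 1 ] * x
    double-neg = solve-∀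

  ∂ss : ∀ n → ss (suc n) ≡ cs n + cs n
  ∂ss n = cong₂ _+_ (⊛-cong ∂sin (λ _ → refl) n)
                    (trans (⊛-cong (λ _ → refl) ∂sin n) (⊛-comm sinᶜ cosᶜ n))

  ∂cs : ∀ n → cs (suc n) ≡ -1ℤ * ss n + cc n
  ∂cs n = cong₂ _+_ (trans (⊛-cong ∂cos (λ _ → refl) n) (⊛-scalarˡ -1ℤ sinᶜ sinᶜ n))
                    (⊛-cong (λ _ → refl) ∂sin n)

  pythagoras : cc ⊕ ss ≗ one
  pythagoras zero    = refl
  pythagoras (suc n) = trans (cong₂ _+_ (∂cc n) (∂ss n)) (cancel (cs n))
    where
    cancel : ∀ x → ℤ.-[1+ 1 ] * x + (x + x) ≡ 0ℤ
    cancel = solve-∀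

  -- cos t sin t = sin (2t) / 2 satisfies y'' = -4 y
  ∂∂cs : ∀ n → cs (suc (suc n)) ≡ ℤ.-[1+ 3 ] * cs n
  ∂∂cs n = trans (∂cs (suc n)) (trans (cong₂ (λ u v → -1ℤ * u + v) (∂ss n) (∂cc n)) (collect (cs n)))
    where
    collect : ∀ x → -1ℤ * (x + x) + ℤ.-[1+ 1 ] * x ≡ ℤ.-[1+ 3 ] * x
    collect = solve-∀

  cs-even : ∀ q → cs (double q) ≡ 0ℤ
  cs-even zero    = refl
  cs-even (suc q) = trans (∂∂cs (double q)) (cong (ℤ.-[1+ 3 ] *_) (cs-even q))

  cs-odd : ∀ q → cs (suc (double q)) ≡ ℤ.-[1+ 3 ] ^ q
  cs-odd zero    = refl
  cs-odd (suc q) = trans (∂∂cs (suc (double q))) (cong (ℤ.-[1+ 3 ] *_) (cs-odd q))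

  cc-odd : Even cc
  cc-odd q = trans (∂cc (double q)) (cong (ℤ.-[1+ 1 ] *_) (cs-even q))

  cc-even : ∀ q → cc (double (suc q)) ≡ ℤ.-[1+ 1 ] * ℤ.-[1+ 3 ] ^ q
  cc-even q = trans (∂cc (suc (double q))) (cong (ℤ.-[1+ 1 ] *_) (cs-odd q))


module Comparison where
  open import Data.Nat as ℕ using (zero; suc; ⌊_/2⌋)
  open import Data.Integer as ℤ using (ℤ; _+_; _*_; _^_; 0ℤ; 1ℤ; -1ℤ)
  import Data.Integer.Properties as ℤP
  open import Data.Integer.Tactic.RingSolver using (solve-∀)
  open import Data.Product using (_,_)
  open import Data.Sum using (inj₁; inj₂)
  open import Relation.Binary.PropositionalEquality
  open Parity
  open Series
  open Trig

  ^-distribʳ-* : ∀ i j n → (i * j) ^ n ≡ i ^ n * j ^ n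
  ^-distribʳ-* i j zero    = refl
  ^-distribʳ-* i j (suc n) = trans (cong ((i * j) *_) (^-distribʳ-* i j n)) (swap i j (i ^ n) (j ^ n))
    where
    swap : ∀ i j p q → (i * j) * (p * q) ≡ (i * p) * (j * q)
    swap = solve-∀

  -- coefficients of cosh² (t/√2) = (1 + cosh (√2 t)) / 2
  Kᴬ : Seq
  Kᴬ zero                         = 1ℤ
  Kᴬ (suc zero)                   = 0ℤ
  Kᴬ (suc (suc zero))             = 1ℤ
  Kᴬ (suc (suc (suc zero)))       = 0ℤ
  Kᴬ (suc (suc (suc (suc n))))    = ℤ.+ 2 * Kᴬ (suc (suc n))

  Kᴬ-odd : Even Kᴬ
  Kᴬ-odd zero          = refl
  Kᴬ-odd (suc zero)    = refl
  Kᴬ-odd (suc (suc q)) = cong (ℤ.+ 2 *_) (Kᴬ-odd (suc q))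

  Kᴬ-even : ∀ q → Kᴬ (double (suc q)) ≡ (ℤ.+ 2) ^ q
  Kᴬ-even zero    = refl
  Kᴬ-even (suc q) = cong (ℤ.+ 2 *_) (Kᴬ-even q)

  -- coefficients of cosh (√2 t) + sinh (√2 t) / √2
  Pᴬ : Seq
  Pᴬ n = (ℤ.+ 2) ^ ⌊ n /2⌋

  -- the substitution t ↦ √-2 t turns cosh² (t/√2) into cos² t …
  cc-halfScale : cc ≗ halfScale ℤ.-[1+ 1 ] Kᴬ
  cc-halfScale n with parity n
  ... | zero  , inj₁ refl = refl
  ... | suc q , inj₁ refl = begin
      cc (double (suc q))                       ≡⟨ cc-even q ⟩
      ℤ.-[1+ 1 ] * ℤ.-[1+ 3 ] ^ q               ≡⟨ cong (ℤ.-[1+ 1 ] *_) (^-distribʳ-* ℤ.-[1+ 1 ] (ℤ.+ 2) q) ⟩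
      ℤ.-[1+ 1 ] * (ℤ.-[1+ 1 ] ^ q * (ℤ.+ 2) ^ q)  ≡⟨ sym (ℤP.*-assoc ℤ.-[1+ 1 ] (ℤ.-[1+ 1 ] ^ q) ((ℤ.+ 2) ^ q)) ⟩
      ℤ.-[1+ 1 ] ^ suc q * (ℤ.+ 2) ^ q             ≡⟨ sym (cong₂ (λ k v → ℤ.-[1+ 1 ] ^ k * v) (⌊double/2⌋ (suc q)) (Kᴬ-even q)) ⟩
      halfScale ℤ.-[1+ 1 ] Kᴬ (double (suc q))  ∎
    where open ≡-Reasoning
  ... | q , inj₂ refl = trans (cc-odd q) (sym (trans (cong (ℤ.-[1+ 1 ] ^ ⌊ n /2⌋ *_) (Kᴬ-odd q)) (ℤP.*-zeroʳ (ℤ.-[1+ 1 ] ^ ⌊ n /2⌋))))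

  -- … and cosh (√2 t) + sinh (√2 t) / √2 into cos 2t + i sin 2t / √2
  halfScale-Pᴬ : ∀ n → halfScale ℤ.-[1+ 1 ] Pᴬ n ≡ ℤ.-[1+ 3 ] ^ ⌊ n /2⌋
  halfScale-Pᴬ n = sym (^-distribʳ-* ℤ.-[1+ 1 ] (ℤ.+ 2) ⌊ n /2⌋)

  flip-sign : ∀ k → -1ℤ ^ k * ℤ.-[1+ 1 ] ^ k ≡ (ℤ.+ 2) ^ k
  flip-sign k = sym (^-distribʳ-* -1ℤ ℤ.-[1+ 1 ] k)

  -- Let a(t) = P(t) / cosh² (t/√2) and
  -- e(t) = (1 + sin t) / cos t.  Under t ↦ √-2 t the first becomes
  -- (cos 2t + i sin 2t / √2) / cos² t, whose even part is 2 − sec² t = 2 − (e′)_even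
  -- and whose odd part is i √2 tan t = i √2 e_odd.  Without complex numbers we
  -- compare 2 ã with  y = (e − e′) − (e + e′)(−t) + 4  after multiplying both by cos² t.
  module _ (a e : Seq) (a-eq : Kᴬ ⊛ a ≗ Pᴬ) (e-eq : cosᶜ ⊛ e ≗ sinᶜ ⊕ one) where

    ã : Seq
    ã = halfScale ℤ.-[1+ 1 ] a

    cc⊛ã : ∀ n → (cc ⊛ ã) n ≡ ℤ.-[1+ 3 ] ^ ⌊ n /2⌋
    cc⊛ã n = begin
        (cc ⊛ ã) n                                    ≡⟨ ⊛-cong cc-halfScale (λ _ → refl) n ⟩
        (halfScale ℤ.-[1+ 1 ] Kᴬ ⊛ ã) n               ≡⟨ ⊛-halfScale ℤ.-[1+ 1 ] Kᴬ a Kᴬ-odd n ⟩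
        ℤ.-[1+ 1 ] ^ ⌊ n /2⌋ * (Kᴬ ⊛ a) n             ≡⟨ cong (ℤ.-[1+ 1 ] ^ ⌊ n /2⌋ *_) (a-eq n) ⟩
        halfScale ℤ.-[1+ 1 ] Pᴬ n                     ≡⟨ halfScale-Pᴬ n ⟩
        ℤ.-[1+ 3 ] ^ ⌊ n /2⌋                          ∎
      where open ≡-Reasoning

    cc⊛e : cc ⊛ e ≗ cs ⊕ cosᶜ
    cc⊛e n = begin
        (cc ⊛ e) n                 ≡⟨ ⊛-assoc cosᶜ cosᶜ e n ⟩
        (cosᶜ ⊛ (cosᶜ ⊛ e)) n      ≡⟨ ⊛-cong (λ _ → refl) e-eq n ⟩
        (cosᶜ ⊛ (sinᶜ ⊕ one)) n    ≡⟨ ⊛-distribˡ cosᶜ sinᶜ one n ⟩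
        cs n + (cosᶜ ⊛ one) n      ≡⟨ cong (cs n +_) (⊛-identityʳ cosᶜ n) ⟩
        cs n + cosᶜ n              ∎
      where open ≡-Reasoning

    -- differentiating cos e = sin + 1 gives cos e′ = cos + sin e
    cos⊛∂e : cosᶜ ⊛ ∂ e ≗ cosᶜ ⊕ sinᶜ ⊛ e
    cos⊛∂e n = isolate ((sinᶜ ⊛ e) n) ((cosᶜ ⊛ ∂ e) n) (cosᶜ n) (begin
        -1ℤ * (sinᶜ ⊛ e) n + (cosᶜ ⊛ ∂ e) n
      ≡⟨ cong (_+ (cosᶜ ⊛ ∂ e) n) (sym (trans (⊛-cong ∂cos (λ _ → refl) n) (⊛-scalarˡ -1ℤ sinᶜ e n))) ⟩
        (cosᶜ ⊛ e) (suc n)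
      ≡⟨ e-eq (suc n) ⟩
        sinᶜ (suc n) + 0ℤ
      ≡⟨ cong (_+ 0ℤ) (∂sin n) ⟩
        cosᶜ n + 0ℤ
      ∎)
      where
      open ≡-Reasoning
      isolate : ∀ w y z → -1ℤ * w + y ≡ z + 0ℤ → y ≡ z + w
      isolate w y z eq = trans (split w y) (trans (cong (_+ w) eq) (drop-zero z w))
        where
        split : ∀ w y → y ≡ (-1ℤ * w + y) + w
        split = solve-∀
        drop-zero : ∀ z w → (z + 0ℤ) + w ≡ z + w
        drop-zero = solve-∀

    cc⊛∂e : cc ⊛ ∂ e ≗ one ⊕ sinᶜ
    cc⊛∂e n = begin
        (cc ⊛ ∂ e) n                    ≡⟨ ⊛-assoc cosᶜ cosᶜ (∂ e) n ⟩
        (cosᶜ ⊛ (cosᶜ ⊛ ∂ e)) n         ≡⟨ ⊛-cong (λ _ → refl) cos⊛∂e n ⟩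
        (cosᶜ ⊛ (cosᶜ ⊕ sinᶜ ⊛ e)) n    ≡⟨ ⊛-distribˡ cosᶜ cosᶜ (sinᶜ ⊛ e) n ⟩
        cc n + (cosᶜ ⊛ (sinᶜ ⊛ e)) n    ≡⟨ cong (cc n +_) sin-part ⟩
        cc n + (ss n + sinᶜ n)          ≡⟨ sym (ℤP.+-assoc (cc n) (ss n) (sinᶜ n)) ⟩
        (cc n + ss n) + sinᶜ n          ≡⟨ cong (_+ sinᶜ n) (pythagoras n) ⟩
        one n + sinᶜ n                  ∎
      where
      open ≡-Reasoning
      sin-part : (cosᶜ ⊛ (sinᶜ ⊛ e)) n ≡ ss n + sinᶜ n
      sin-part = begin
          (cosᶜ ⊛ (sinᶜ ⊛ e)) n      ≡⟨ sym (⊛-assoc cosᶜ sinᶜ e n) ⟩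
          (cs ⊛ e) n                 ≡⟨ ⊛-cong (⊛-comm cosᶜ sinᶜ) (λ _ → refl) n ⟩
          ((sinᶜ ⊛ cosᶜ) ⊛ e) n      ≡⟨ ⊛-assoc sinᶜ cosᶜ e n ⟩
          (sinᶜ ⊛ (cosᶜ ⊛ e)) n      ≡⟨ ⊛-cong (λ _ → refl) e-eq n ⟩
          (sinᶜ ⊛ (sinᶜ ⊕ one)) n    ≡⟨ ⊛-distribˡ sinᶜ sinᶜ one n ⟩
          ss n + (sinᶜ ⊛ one) n      ≡⟨ cong (ss n +_) (⊛-identityʳ sinᶜ n) ⟩
          ss n + sinᶜ n              ∎

    -- twice the odd part of e, minus twice the even part of e′ (up to the t⁰ term)
    y : Seq
    y = (e ⊕ -1ℤ · ∂ e) ⊕ -1ℤ · scale -1ℤ (e ⊕ ∂ e) ⊕ (ℤ.+ 4) · one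

    cc⊛y : ∀ n → (cc ⊛ y) n ≡ ((cs n + cosᶜ n) + -1ℤ * (one n + sinᶜ n))
                              + -1ℤ * (-1ℤ ^ n * ((cs n + cosᶜ n) + (one n + sinᶜ n)))
                              + (ℤ.+ 4) * cc n
    cc⊛y n = begin
        (cc ⊛ y) n
      ≡⟨ ⊛-distribˡ cc _ ((ℤ.+ 4) · one) n ⟩
        (cc ⊛ ((e ⊕ -1ℤ · ∂ e) ⊕ -1ℤ · scale -1ℤ (e ⊕ ∂ e))) n + (cc ⊛ (ℤ.+ 4) · one) n
      ≡⟨ cong₂ _+_ (⊛-distribˡ cc (e ⊕ -1ℤ · ∂ e) _ n) (⊛-scalarʳ (ℤ.+ 4) cc one n) ⟩
        (cc ⊛ (e ⊕ -1ℤ · ∂ e)) n + (cc ⊛ -1ℤ · scale -1ℤ (e ⊕ ∂ e)) n + (ℤ.+ 4) * (cc ⊛ one) n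
      ≡⟨ cong₂ _+_ (cong₂ _+_ difference reflected) (cong ((ℤ.+ 4) *_) (⊛-identityʳ cc n)) ⟩
        ((cs n + cosᶜ n) + -1ℤ * (one n + sinᶜ n))
          + -1ℤ * (-1ℤ ^ n * ((cs n + cosᶜ n) + (one n + sinᶜ n))) + (ℤ.+ 4) * cc n
      ∎
      where
      open ≡-Reasoning
      difference : (cc ⊛ (e ⊕ -1ℤ · ∂ e)) n ≡ (cs n + cosᶜ n) + -1ℤ * (one n + sinᶜ n)
      difference = trans (⊛-distribˡ cc e (-1ℤ · ∂ e) n)
        (cong₂ _+_ (cc⊛e n) (trans (⊛-scalarʳ -1ℤ cc (∂ e) n) (cong (-1ℤ *_) (cc⊛∂e n))))
      reflected : (cc ⊛ -1ℤ · scale -1ℤ (e ⊕ ∂ e)) n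
                  ≡ -1ℤ * (-1ℤ ^ n * ((cs n + cosᶜ n) + (one n + sinᶜ n)))
      reflected = trans (⊛-scalarʳ -1ℤ cc _ n) (cong (-1ℤ *_)
        (trans (⊛-reflect cc (e ⊕ ∂ e) cc-odd n) (cong (-1ℤ ^ n *_)
          (trans (⊛-distribˡ cc e (∂ e) n) (cong₂ _+_ (cc⊛e n) (cc⊛∂e n))))))

    agree : cc ⊛ (ℤ.+ 2) · ã ≗ cc ⊛ y
    agree n = trans (⊛-scalarʳ (ℤ.+ 2) cc ã n)
                    (trans (cong (ℤ.+ 2 *_) (cc⊛ã n)) (sym (trans (cc⊛y n) (by-parity n))))
      where
      by-parity : ∀ n → ((cs n + cosᶜ n) + -1ℤ * (one n + sinᶜ n))
                        + -1ℤ * (-1ℤ ^ n * ((cs n + cosᶜ n) + (one n + sinᶜ n))) + (ℤ.+ 4) * cc n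
                        ≡ ℤ.+ 2 * ℤ.-[1+ 3 ] ^ ⌊ n /2⌋
      by-parity n with parity n
      ... | zero , inj₁ refl = refl
      ... | suc q , inj₁ refl
        rewrite cs-even (suc q) | cos-even (suc q) | sin-even (suc q) | -1^double (suc q)
              | cc-even q | ⌊double/2⌋ q = even-identity (-1ℤ ^ suc q) (ℤ.-[1+ 3 ] ^ q)
        where
        even-identity : ∀ u r → ((0ℤ + u) + -1ℤ * (0ℤ + 0ℤ)) + -1ℤ * (1ℤ * ((0ℤ + u) + (0ℤ + 0ℤ)))
                                + ℤ.+ 4 * (ℤ.-[1+ 1 ] * r) ≡ ℤ.+ 2 * (ℤ.-[1+ 3 ] * r)
        even-identity = solve-∀
      ... | q , inj₂ refl
        rewrite cs-odd q | cos-odd q | sin-odd q | -1^odd q | cc-odd q | ⌊odd/2⌋ q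
          = odd-identity (ℤ.-[1+ 3 ] ^ q) (-1ℤ ^ q)
        where
        odd-identity : ∀ c s → ((c + 0ℤ) + -1ℤ * (0ℤ + s)) + -1ℤ * (-1ℤ * ((c + 0ℤ) + (0ℤ + s)))
                               + ℤ.+ 4 * 0ℤ ≡ ℤ.+ 2 * c
        odd-identity = solve-∀

    scaled : (ℤ.+ 2) · ã ≗ y
    scaled = ⊛-cancelˡ cc ((ℤ.+ 2) · ã) y refl agree

    odd-coefficients : ∀ m → (ℤ.+ 2) ^ m * a (suc (double m)) ≡ -1ℤ ^ m * e (suc (double m))
    odd-coefficients m = begin
        (ℤ.+ 2) ^ m * a n                            ≡⟨ cong (_* a n) (sym (flip-sign m)) ⟩
        (-1ℤ ^ m * ℤ.-[1+ 1 ] ^ m) * a n             ≡⟨ ℤP.*-assoc (-1ℤ ^ m) _ (a n) ⟩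
        -1ℤ ^ m * (ℤ.-[1+ 1 ] ^ m * a n)             ≡⟨ cong (-1ℤ ^ m *_) ã≡e ⟩
        -1ℤ ^ m * e n                                ∎
      where
      open ≡-Reasoning
      n = suc (double m)
      collect : ∀ u v → (u + -1ℤ * v) + -1ℤ * (-1ℤ * (u + v)) + ℤ.+ 4 * 0ℤ ≡ ℤ.+ 2 * u
      collect = solve-∀
      ã≡e : ℤ.-[1+ 1 ] ^ m * a n ≡ e n
      ã≡e = ℤP.*-cancelˡ-≡ (ℤ.+ 2) _ _ (begin
          ℤ.+ 2 * (ℤ.-[1+ 1 ] ^ m * a n)
        ≡⟨ cong (λ k → ℤ.+ 2 * (ℤ.-[1+ 1 ] ^ k * a n)) (sym (⌊odd/2⌋ m)) ⟩
          ℤ.+ 2 * ã n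
        ≡⟨ scaled n ⟩
          y n
        ≡⟨ cong (λ s → (e n + -1ℤ * e (suc n)) + -1ℤ * (s * (e n + e (suc n))) + ℤ.+ 4 * 0ℤ) (-1^odd m) ⟩
          (e n + -1ℤ * e (suc n)) + -1ℤ * (-1ℤ * (e n + e (suc n))) + ℤ.+ 4 * 0ℤ
        ≡⟨ collect (e n) (e (suc n)) ⟩
          ℤ.+ 2 * e n
        ∎)

    even-coefficients : ∀ m → (ℤ.+ 2) ^ suc m * a (double (suc m)) ≡ -1ℤ ^ m * e (suc (double (suc m)))
    even-coefficients m = begin
        (ℤ.+ 2) ^ suc m * a n                                  ≡⟨ cong (_* a n) (sym (flip-sign (suc m))) ⟩
        (-1ℤ ^ suc m * ℤ.-[1+ 1 ] ^ suc m) * a n               ≡⟨ ℤP.*-assoc (-1ℤ ^ suc m) _ (a n) ⟩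
        -1ℤ ^ suc m * (ℤ.-[1+ 1 ] ^ suc m * a n)               ≡⟨ cong (-1ℤ ^ suc m *_) ã≡-e′ ⟩
        -1ℤ ^ suc m * (-1ℤ * e (suc n))                        ≡⟨ sign-square (-1ℤ ^ m) (e (suc n)) ⟩
        -1ℤ ^ m * e (suc n)                                    ∎
      where
      open ≡-Reasoning
      n = double (suc m)
      sign-square : ∀ s x → (-1ℤ * s) * (-1ℤ * x) ≡ s * x
      sign-square = solve-∀
      collect : ∀ u v → (u + -1ℤ * v) + -1ℤ * (1ℤ * (u + v)) + ℤ.+ 4 * 0ℤ ≡ ℤ.+ 2 * (-1ℤ * v)
      collect = solve-∀
      ã≡-e′ : ℤ.-[1+ 1 ] ^ suc m * a n ≡ -1ℤ * e (suc n)
      ã≡-e′ = ℤP.*-cancelˡ-≡ (ℤ.+ 2) _ _ (begin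
          ℤ.+ 2 * (ℤ.-[1+ 1 ] ^ suc m * a n)
        ≡⟨ cong (λ k → ℤ.+ 2 * (ℤ.-[1+ 1 ] ^ k * a n)) (sym (⌊double/2⌋ (suc m))) ⟩
          ℤ.+ 2 * ã n
        ≡⟨ scaled n ⟩
          y n
        ≡⟨ cong (λ s → (e n + -1ℤ * e (suc n)) + -1ℤ * (s * (e n + e (suc n))) + ℤ.+ 4 * 0ℤ) (-1^double (suc m)) ⟩
          (e n + -1ℤ * e (suc n)) + -1ℤ * (1ℤ * (e n + e (suc n))) + ℤ.+ 4 * 0ℤ
        ≡⟨ collect (e n) (e (suc n)) ⟩
          ℤ.+ 2 * (-1ℤ * e (suc n))
        ∎)


module Permutations where
  open import Defs using (words; perms)
  open import Data.Nat as ℕ using (ℕ; zero; suc; _<_; _≤_; z≤n; s≤s; _<ᵇ_; _≡ᵇ_)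
  import Data.Nat.Properties as ℕP
  open import Data.Bool using (Bool; true; false; not; if_then_else_; _∧_)
  open import Data.List using (List; []; _∷_; map; concatMap; filter; upTo; applyUpTo; _++_)
  open import Data.List.Relation.Unary.All using (all?)
  open import Data.List.Relation.Unary.AllPairs using (allPairs?)
  open import Data.Integer as ℤ using (ℤ; _+_; _*_; 0ℤ; 1ℤ)
  import Data.Integer.Properties as ℤP
  open import Data.Empty using (⊥-elim)
  open import Data.Sum using (inj₁; inj₂)
  open import Function using (_∘_)
  open import Relation.Nullary.Decidable using (does; ¬?)
  open import Relation.Unary using (Pred; Decidable)
  open import Level using (0ℓ)
  open import Relation.Binary.PropositionalEquality
  open Series using (∑; ∑-cong)

  ⟦_⟧ : Bool → ℤ
  ⟦ true  ⟧ = 1ℤ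
  ⟦ false ⟧ = 0ℤ

  ⟦∧⟧ : ∀ x y → ⟦ x ∧ y ⟧ ≡ ⟦ x ⟧ * ⟦ y ⟧
  ⟦∧⟧ true  y = sym (ℤP.*-identityˡ ⟦ y ⟧)
  ⟦∧⟧ false y = refl

  ∑ₗ : {A : Set} → List A → (A → ℤ) → ℤ
  ∑ₗ []       f = 0ℤ
  ∑ₗ (x ∷ xs) f = f x + ∑ₗ xs f

  ∑ₗ-cong : ∀ {A : Set} (xs : List A) {f g : A → ℤ} → (∀ x → f x ≡ g x) → ∑ₗ xs f ≡ ∑ₗ xs g
  ∑ₗ-cong []       h = refl
  ∑ₗ-cong (x ∷ xs) h = cong₂ _+_ (h x) (∑ₗ-cong xs h)

  ∑ₗ-++ : ∀ {A : Set} (xs ys : List A) (f : A → ℤ) → ∑ₗ (xs ++ ys) f ≡ ∑ₗ xs f + ∑ₗ ys f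
  ∑ₗ-++ []       ys f = sym (ℤP.+-identityˡ (∑ₗ ys f))
  ∑ₗ-++ (x ∷ xs) ys f = trans (cong (f x +_) (∑ₗ-++ xs ys f)) (sym (ℤP.+-assoc (f x) (∑ₗ xs f) (∑ₗ ys f)))

  ∑ₗ-concatMap : ∀ {A B : Set} (F : A → List B) (xs : List A) (h : B → ℤ) →
                 ∑ₗ (concatMap F xs) h ≡ ∑ₗ xs (λ a → ∑ₗ (F a) h)
  ∑ₗ-concatMap F []       h = refl
  ∑ₗ-concatMap F (a ∷ xs) h = trans (∑ₗ-++ (F a) (concatMap F xs) h) (cong (∑ₗ (F a) h +_) (∑ₗ-concatMap F xs h))

  ∑ₗ-map : ∀ {A B : Set} (g : A → B) (xs : List A) (h : B → ℤ) → ∑ₗ (map g xs) h ≡ ∑ₗ xs (h ∘ g)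
  ∑ₗ-map g []       h = refl
  ∑ₗ-map g (x ∷ xs) h = cong (h (g x) +_) (∑ₗ-map g xs h)

  ∑ₗ-* : ∀ {A : Set} (xs : List A) (c : ℤ) (f : A → ℤ) → ∑ₗ xs (λ x → c * f x) ≡ c * ∑ₗ xs f
  ∑ₗ-* []       c f = sym (ℤP.*-zeroʳ c)
  ∑ₗ-* (x ∷ xs) c f = trans (cong (c * f x +_) (∑ₗ-* xs c f)) (sym (ℤP.*-distribˡ-+ c (f x) (∑ₗ xs f)))

  ∑ₗ-filter : ∀ {A : Set} {P : Pred A 0ℓ} (P? : Decidable P) (xs : List A) (g : A → ℤ) →
              ∑ₗ (filter P? xs) g ≡ ∑ₗ xs (λ x → ⟦ does (P? x) ⟧ * g x)
  ∑ₗ-filter P? []       g = refl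
  ∑ₗ-filter P? (x ∷ xs) g with does (P? x)
  ... | true  = cong₂ _+_ (sym (ℤP.*-identityˡ (g x))) (∑ₗ-filter P? xs g)
  ... | false = trans (∑ₗ-filter P? xs g) (sym (ℤP.+-identityˡ _))

  wordsOver : List ℕ → ℕ → List (List ℕ)
  wordsOver L zero    = [] ∷ []
  wordsOver L (suc k) = concatMap (λ a → map (a ∷_) (wordsOver L k)) L

  alphabet : ℕ → List ℕ
  alphabet n = map suc (upTo n)

  words≡wordsOver : ∀ n k → words n k ≡ wordsOver (alphabet n) k
  words≡wordsOver n zero    = refl
  words≡wordsOver n (suc k) = cong (λ W → concatMap (λ a → map (a ∷_) W) (alphabet n)) (words≡wordsOver n k)

  ∑-wordsOver-suc : ∀ L k (h : List ℕ → ℤ) →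
                    ∑ₗ (wordsOver L (suc k)) h ≡ ∑ₗ L (λ a → ∑ₗ (wordsOver L k) (λ w → h (a ∷ w)))
  ∑-wordsOver-suc L k h = trans (∑ₗ-concatMap (λ a → map (a ∷_) (wordsOver L k)) L h)
                                (∑ₗ-cong L (λ a → ∑ₗ-map (a ∷_) (wordsOver L k) h))

  ∑-wordsOver-map : ∀ (g : ℕ → ℕ) L k (h : List ℕ → ℤ) →
                    ∑ₗ (wordsOver (map g L) k) h ≡ ∑ₗ (wordsOver L k) (h ∘ map g)
  ∑-wordsOver-map g L zero    h = refl
  ∑-wordsOver-map g L (suc k) h =
    trans (∑-wordsOver-suc (map g L) k h)
     (trans (∑ₗ-map g L _)
      (trans (∑ₗ-cong L (λ x → ∑-wordsOver-map g L k (λ w → h (g x ∷ w))))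
       (sym (∑-wordsOver-suc L k (h ∘ map g)))))

  fresh : ℕ → List ℕ → Bool
  fresh a []      = true
  fresh a (y ∷ w) = not (a ≡ᵇ y) ∧ fresh a w

  distinct : List ℕ → Bool
  distinct []      = true
  distinct (a ∷ w) = fresh a w ∧ distinct w

  distinct-decides : ∀ w → does (allPairs? (λ x y → ¬? (x ℕP.≟ y)) w) ≡ distinct w
  distinct-decides []      = refl
  distinct-decides (a ∷ w) = cong₂ _∧_ (fresh-decides w) (distinct-decides w)
    where
    fresh-decides : ∀ w → does (all? (λ y → ¬? (a ℕP.≟ y)) w) ≡ fresh a w
    fresh-decides []      = refl
    fresh-decides (y ∷ w) = cong (not (a ≡ᵇ y) ∧_) (fresh-decides w)

  ∑-perms : ∀ m (f : List ℕ → ℤ) →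
            ∑ₗ (perms m) f ≡ ∑ₗ (wordsOver (alphabet m) m) (λ w → ⟦ distinct w ⟧ * f w)
  ∑-perms m f = trans (∑ₗ-filter (allPairs? (λ x y → ¬? (x ℕP.≟ y))) (words m m) f)
    (trans (cong (λ W → ∑ₗ W (λ w → ⟦ does (allPairs? (λ x y → ¬? (x ℕP.≟ y)) w) ⟧ * f w)) (words≡wordsOver m m))
     (∑ₗ-cong (wordsOver (alphabet m) m) (λ w → cong (λ b → ⟦ b ⟧ * f w) (distinct-decides w))))

  without : ℕ → List ℕ → List ℕ
  without a = filter (λ b → ¬? (a ℕP.≟ b))

  ∑-fresh : ∀ a L k (h : List ℕ → ℤ) →
            ∑ₗ (wordsOver L k) (λ w → ⟦ fresh a w ⟧ * h w) ≡ ∑ₗ (wordsOver (without a L) k) h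
  ∑-fresh a L zero    h = cong (_+ 0ℤ) (ℤP.*-identityˡ (h []))
  ∑-fresh a L (suc k) h = begin
      ∑ₗ (wordsOver L (suc k)) (λ w → ⟦ fresh a w ⟧ * h w)
    ≡⟨ ∑-wordsOver-suc L k _ ⟩
      ∑ₗ L (λ b → ∑ₗ (wordsOver L k) (λ w → ⟦ not (a ≡ᵇ b) ∧ fresh a w ⟧ * h (b ∷ w)))
    ≡⟨ ∑ₗ-cong L (λ b → trans (∑ₗ-cong (wordsOver L k) (λ w → split b w))
                              (∑ₗ-* (wordsOver L k) ⟦ not (a ≡ᵇ b) ⟧ (λ w → ⟦ fresh a w ⟧ * h (b ∷ w)))) ⟩
      ∑ₗ L (λ b → ⟦ not (a ≡ᵇ b) ⟧ * ∑ₗ (wordsOver L k) (λ w → ⟦ fresh a w ⟧ * h (b ∷ w)))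
    ≡⟨ ∑ₗ-cong L (λ b → cong (⟦ not (a ≡ᵇ b) ⟧ *_) (∑-fresh a L k (λ w → h (b ∷ w)))) ⟩
      ∑ₗ L (λ b → ⟦ not (a ≡ᵇ b) ⟧ * ∑ₗ (wordsOver (without a L) k) (λ w → h (b ∷ w)))
    ≡⟨ sym (∑ₗ-filter (λ b → ¬? (a ℕP.≟ b)) L _) ⟩
      ∑ₗ (without a L) (λ b → ∑ₗ (wordsOver (without a L) k) (λ w → h (b ∷ w)))
    ≡⟨ sym (∑-wordsOver-suc (without a L) k h) ⟩
      ∑ₗ (wordsOver (without a L) (suc k)) h
    ∎
    where
    open ≡-Reasoning
    split : ∀ b w → ⟦ not (a ≡ᵇ b) ∧ fresh a w ⟧ * h (b ∷ w) ≡ ⟦ not (a ≡ᵇ b) ⟧ * (⟦ fresh a w ⟧ * h (b ∷ w))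
    split b w = trans (cong (_* h (b ∷ w)) (⟦∧⟧ (not (a ≡ᵇ b)) (fresh a w)))
                      (ℤP.*-assoc ⟦ not (a ≡ᵇ b) ⟧ ⟦ fresh a w ⟧ (h (b ∷ w)))

  <ᵇ-true : ∀ {x a} → x < a → (x <ᵇ a) ≡ true
  <ᵇ-true {zero}  {suc a} _       = refl
  <ᵇ-true {suc x} {suc a} (s≤s p) = <ᵇ-true p

  <ᵇ-false : ∀ {x a} → a ≤ x → (x <ᵇ a) ≡ false
  <ᵇ-false {x}     {zero}  _       = refl
  <ᵇ-false {suc x} {suc a} (s≤s p) = <ᵇ-false p

  <ᵇ-true⁻¹ : ∀ x a → (x <ᵇ a) ≡ true → x < a
  <ᵇ-true⁻¹ zero    (suc a) e = s≤s z≤n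
  <ᵇ-true⁻¹ (suc x) (suc a) e = s≤s (<ᵇ-true⁻¹ x a e)

  <ᵇ-false⁻¹ : ∀ x a → (x <ᵇ a) ≡ false → a ≤ x
  <ᵇ-false⁻¹ x       zero    e = z≤n
  <ᵇ-false⁻¹ (suc x) (suc a) e = s≤s (<ᵇ-false⁻¹ x a e)

  ≡ᵇ-< : ∀ {x y} → x < y → (x ≡ᵇ y) ≡ false
  ≡ᵇ-< {zero}  {suc y} _       = refl
  ≡ᵇ-< {suc x} {suc y} (s≤s p) = ≡ᵇ-< p

  ≡ᵇ-> : ∀ {x y} → y < x → (x ≡ᵇ y) ≡ false
  ≡ᵇ-> {suc x} {zero}  _       = refl
  ≡ᵇ-> {suc x} {suc y} (s≤s p) = ≡ᵇ-> p

  ≡ᵇ-refl : ∀ x → (x ≡ᵇ x) ≡ true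
  ≡ᵇ-refl zero    = refl
  ≡ᵇ-refl (suc x) = ≡ᵇ-refl x

  -- skip a: the order-preserving injection ℕ → ℕ ∖ {a}; it standardises a
  -- permutation of [n] into the remaining letters after the first letter a
  skip : ℕ → ℕ → ℕ
  skip a x = if x <ᵇ a then x else suc x

  -- skip a is an order embedding (x < a ≤ y gives skip x = x < y < suc y = skip y)
  skip-≡ᵇ : ∀ a x y → (skip a x ≡ᵇ skip a y) ≡ (x ≡ᵇ y)
  skip-≡ᵇ a x y with x <ᵇ a in ex | y <ᵇ a in ey
  ... | true  | true  = refl
  ... | false | false = refl
  ... | true  | false = trans (≡ᵇ-< (ℕP.≤-trans x<a (ℕP.m≤n⇒m≤1+n (<ᵇ-false⁻¹ y a ey))))
                             (sym (≡ᵇ-< (ℕP.<-≤-trans x<a (<ᵇ-false⁻¹ y a ey))))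
    where x<a = <ᵇ-true⁻¹ x a ex
  ... | false | true  = trans (≡ᵇ-> (ℕP.≤-trans y<a (ℕP.m≤n⇒m≤1+n (<ᵇ-false⁻¹ x a ex))))
                             (sym (≡ᵇ-> (ℕP.<-≤-trans y<a (<ᵇ-false⁻¹ x a ex))))
    where y<a = <ᵇ-true⁻¹ y a ey

  skip-<ᵇ : ∀ a x y → (skip a x <ᵇ skip a y) ≡ (x <ᵇ y)
  skip-<ᵇ a x y with x <ᵇ a in ex | y <ᵇ a in ey
  ... | true  | true  = refl
  ... | false | false = refl
  ... | true  | false = trans (<ᵇ-true (ℕP.≤-trans x<a (ℕP.m≤n⇒m≤1+n (<ᵇ-false⁻¹ y a ey))))
                             (sym (<ᵇ-true (ℕP.<-≤-trans x<a (<ᵇ-false⁻¹ y a ey))))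
    where x<a = <ᵇ-true⁻¹ x a ex
  ... | false | true  = trans (<ᵇ-false (ℕP.<⇒≤ (ℕP.≤-trans y<a (ℕP.m≤n⇒m≤1+n (<ᵇ-false⁻¹ x a ex)))))
                             (sym (<ᵇ-false (ℕP.<⇒≤ (ℕP.<-≤-trans y<a (<ᵇ-false⁻¹ x a ex)))))
    where y<a = <ᵇ-true⁻¹ y a ey

  distinct-skip : ∀ a w → distinct (map (skip a) w) ≡ distinct w
  distinct-skip a []      = refl
  distinct-skip a (x ∷ w) = cong₂ _∧_ (fresh-skip w) (distinct-skip a w)
    where
    fresh-skip : ∀ w → fresh (skip a x) (map (skip a) w) ≡ fresh x w
    fresh-skip []      = refl
    fresh-skip (y ∷ w) = cong₂ (λ u v → not u ∧ v) (skip-≡ᵇ a x y) (fresh-skip w)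

  interval : ℕ → ℕ → List ℕ
  interval s zero    = []
  interval s (suc m) = s ∷ interval (suc s) m

  alphabet≡interval : ∀ m → alphabet m ≡ interval 1 m
  alphabet≡interval m = go (λ k → k) 0 m (λ k → refl)
    where
    go : ∀ (f : ℕ → ℕ) s m → (∀ k → f k ≡ s ℕ.+ k) → map suc (applyUpTo f m) ≡ interval (suc s) m
    go f s zero    h = refl
    go f s (suc m) h = cong₂ _∷_ (cong suc (trans (h 0) (ℕP.+-identityʳ s)))
      (go (f ∘ suc) (suc s) m (λ k → trans (h (suc k)) (ℕP.+-suc s k)))

  ∑ₗ-interval : ∀ s m (F : ℕ → ℤ) → ∑ₗ (interval s m) F ≡ ∑ m (λ i → F (s ℕ.+ i))
  ∑ₗ-interval s zero    F = refl
  ∑ₗ-interval s (suc m) F = cong₂ _+_ (cong F (sym (ℕP.+-identityʳ s)))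
    (trans (∑ₗ-interval (suc s) m F) (∑-cong m (λ i _ → cong F (sym (ℕP.+-suc s i)))))

  without-interval : ∀ m s a → s ≤ a → a ≤ s ℕ.+ m → without a (interval s (suc m)) ≡ map (skip a) (interval s m)
  without-interval m s a s≤a a≤ with ℕP.m≤n⇒m<n∨m≡n s≤a
  ... | inj₂ refl rewrite ≡ᵇ-refl s = trans (keep-above (ℕP.n<1+n s) m) (sym (skip-below ℕP.≤-refl m))
    where
    keep-above : ∀ {t} → s < t → ∀ m → without s (interval t m) ≡ interval t m
    keep-above s<t zero = refl
    keep-above {t} s<t (suc m) rewrite ≡ᵇ-< s<t = cong (t ∷_) (keep-above (ℕP.m<n⇒m<1+n s<t) m)
    skip-below : ∀ {t} → s ≤ t → ∀ m → map (skip s) (interval t m) ≡ interval (suc t) m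
    skip-below s≤t zero = refl
    skip-below {t} s≤t (suc m) rewrite <ᵇ-false s≤t = cong (suc t ∷_) (skip-below (ℕP.m≤n⇒m≤1+n s≤t) m)
  without-interval zero    s a s≤a a≤ | inj₁ s<a =
    ⊥-elim (ℕP.<⇒≱ s<a (ℕP.≤-trans a≤ (ℕP.≤-reflexive (ℕP.+-identityʳ s))))
  without-interval (suc m) s a s≤a a≤ | inj₁ s<a rewrite ≡ᵇ-> s<a | <ᵇ-true s<a =
    cong (s ∷_) (without-interval m (suc s) a s<a (ℕP.≤-trans a≤ (ℕP.≤-reflexive (ℕP.+-suc s m))))

  first-letter : ∀ n (f : List ℕ → ℤ) →
    ∑ₗ (perms (suc n)) f ≡ ∑ (suc n) (λ i → ∑ₗ (perms n) (λ σ → f (suc i ∷ map (skip (suc i)) σ)))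
  first-letter n f = begin
      ∑ₗ (perms (suc n)) f
    ≡⟨ ∑-perms (suc n) f ⟩
      ∑ₗ (wordsOver L (suc n)) (λ w → ⟦ distinct w ⟧ * f w)
    ≡⟨ ∑-wordsOver-suc L n _ ⟩
      ∑ₗ L (λ a → ∑ₗ (wordsOver L n) (λ w → ⟦ fresh a w ∧ distinct w ⟧ * f (a ∷ w)))
    ≡⟨ ∑ₗ-cong L (λ a → trans (∑ₗ-cong (wordsOver L n) (split a)) (∑-fresh a L n (λ w → ⟦ distinct w ⟧ * f (a ∷ w)))) ⟩
      ∑ₗ L (λ a → rest a)
    ≡⟨ cong (λ X → ∑ₗ X rest) (alphabet≡interval (suc n)) ⟩
      ∑ₗ (interval 1 (suc n)) rest
    ≡⟨ ∑ₗ-interval 1 (suc n) rest ⟩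
      ∑ (suc n) (λ i → rest (suc i))
    ≡⟨ ∑-cong (suc n) (λ i i≤n → standardise i (ℕP.≤-pred i≤n)) ⟩
      ∑ (suc n) (λ i → ∑ₗ (perms n) (λ σ → f (suc i ∷ map (skip (suc i)) σ)))
    ∎
    where
    open ≡-Reasoning
    L = alphabet (suc n)
    rest : ℕ → ℤ
    rest a = ∑ₗ (wordsOver (without a L) n) (λ w → ⟦ distinct w ⟧ * f (a ∷ w))
    split : ∀ a w → ⟦ fresh a w ∧ distinct w ⟧ * f (a ∷ w) ≡ ⟦ fresh a w ⟧ * (⟦ distinct w ⟧ * f (a ∷ w))
    split a w = trans (cong (_* f (a ∷ w)) (⟦∧⟧ (fresh a w) (distinct w)))
                      (ℤP.*-assoc ⟦ fresh a w ⟧ ⟦ distinct w ⟧ (f (a ∷ w)))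
    standardise : ∀ i → i ≤ n → rest (suc i) ≡ ∑ₗ (perms n) (λ σ → f (suc i ∷ map (skip (suc i)) σ))
    standardise i i≤n = begin
        rest (suc i)
      ≡⟨ cong (λ X → ∑ₗ (wordsOver X n) (λ w → ⟦ distinct w ⟧ * f (suc i ∷ w))) remaining ⟩
        ∑ₗ (wordsOver (map (skip (suc i)) (alphabet n)) n) (λ w → ⟦ distinct w ⟧ * f (suc i ∷ w))
      ≡⟨ ∑-wordsOver-map (skip (suc i)) (alphabet n) n _ ⟩
        ∑ₗ (wordsOver (alphabet n) n) (λ σ → ⟦ distinct (map (skip (suc i)) σ) ⟧ * f (suc i ∷ map (skip (suc i)) σ))
      ≡⟨ ∑ₗ-cong (wordsOver (alphabet n) n) (λ σ → cong (λ b → ⟦ b ⟧ * f (suc i ∷ map (skip (suc i)) σ)) (distinct-skip (suc i) σ)) ⟩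
        ∑ₗ (wordsOver (alphabet n) n) (λ σ → ⟦ distinct σ ⟧ * f (suc i ∷ map (skip (suc i)) σ))
      ≡⟨ sym (∑-perms n (λ σ → f (suc i ∷ map (skip (suc i)) σ))) ⟩
        ∑ₗ (perms n) (λ σ → f (suc i ∷ map (skip (suc i)) σ))
      ∎
      where
      remaining : without (suc i) L ≡ map (skip (suc i)) (alphabet n)
      remaining = trans (cong (without (suc i)) (alphabet≡interval (suc n)))
                   (trans (without-interval n 1 (suc i) (s≤s z≤n) (s≤s i≤n))
                          (cong (map (skip (suc i))) (sym (alphabet≡interval n))))


module Transfer where
  open import Data.Nat as ℕ using (ℕ; zero; suc; _∸_; _<_; _≤_; s≤s; _<ᵇ_; ⌊_/2⌋)
  import Data.Nat.Properties as ℕP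
  open import Data.Bool using (Bool; true; false; not; if_then_else_)
  open import Data.List using (List; []; _∷_; map)
  open import Data.Integer as ℤ using (ℤ; _+_; _*_; _-_; _^_; 0ℤ; 1ℤ)
  import Data.Integer.Properties as ℤP
  open import Data.Integer.Tactic.RingSolver using (solve-∀)
  open import Data.Product using (_,_)
  open import Data.Sum using (inj₁; inj₂)
  open import Relation.Binary.PropositionalEquality
  open Parity
  open Series
  open import Defs using (perms)
  open Permutations

  -- A local weight w b d u weighs an adjacent pair (x, y) of a word by the
  -- parity b of its position (true for odd), whether it is a descent
  -- (d = y <ᵇ x) and whether it is an ascent (u = x <ᵇ y).
  LocalWeight : Set
  LocalWeight = Bool → Bool → Bool → ℤ

  weight : LocalWeight → Bool → List ℕ → ℤ
  weight w b []          = 1ℤ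
  weight w b (x ∷ [])    = 1ℤ
  weight w b (x ∷ y ∷ v) = w b (y <ᵇ x) (x <ᵇ y) * weight w (not b) (y ∷ v)

  -- on words with distinct letters only the descent flag matters
  PairWeight : Set
  PairWeight = Bool → Bool → ℤ

  pairWeight : LocalWeight → PairWeight
  pairWeight w b d = w b d (not d)

  -- The boustrophedon recursion.  R G n b i is the G-weighted count of the
  -- permutations of [n+1] with first letter i + 1, and T G n b the total.
  R : PairWeight → ℕ → Bool → ℕ → ℤ
  R G zero    b i = 1ℤ
  R G (suc n) b i = ∑ (suc n) (λ c → G b (c <ᵇ i) * R G n (not b) c)

  T : PairWeight → ℕ → Bool → ℤ
  T G n b = ∑ (suc n) (R G n b)

  -- weights see only the relative order of the letters
  weight-skip : ∀ w b a σ → weight w b (map (skip a) σ) ≡ weight w b σ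
  weight-skip w b a []          = refl
  weight-skip w b a (x ∷ [])    = refl
  weight-skip w b a (x ∷ y ∷ v) =
    cong₂ _*_ (cong₂ (w b) (skip-<ᵇ a y x) (skip-<ᵇ a x y)) (weight-skip w (not b) a (y ∷ v))

  -- comparing the second letter (c + 1, standardised) with the first letter i + 1
  descent-rank : ∀ i c → (skip (suc i) (suc c) <ᵇ suc i) ≡ (c <ᵇ i)
  descent-rank i c with c <ᵇ i in e
  ... | true  = e
  ... | false = <ᵇ-false (ℕP.m≤n⇒m≤1+n (<ᵇ-false⁻¹ c i e))

  ascent-rank : ∀ i c → (suc i <ᵇ skip (suc i) (suc c)) ≡ not (c <ᵇ i)
  ascent-rank i c with c <ᵇ i in e
  ... | true  = <ᵇ-false (ℕP.<⇒≤ (<ᵇ-true⁻¹ c i e))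
  ... | false = <ᵇ-true (s≤s (<ᵇ-false⁻¹ c i e))

  module _ (w : LocalWeight) where
    private
      G = pairWeight w

    starting-with : ∀ n b i →
      ∑ₗ (perms n) (λ σ → weight w b (suc i ∷ map (skip (suc i)) σ)) ≡ R G n b i
    starting-with zero    b i = refl
    starting-with (suc n) b i =
      trans (first-letter n (λ π → weight w b (suc i ∷ map (skip (suc i)) π)))
       (∑-cong (suc n) (λ c _ →
         trans (∑ₗ-cong (perms n) (λ τ → cong₂ _*_ (cong₂ (w b) (descent-rank i c) (ascent-rank i c))
                                                   (weight-skip w (not b) (suc i) (suc c ∷ map (skip (suc c)) τ))))
          (trans (∑ₗ-* (perms n) (G b (c <ᵇ i)) (λ τ → weight w (not b) (suc c ∷ map (skip (suc c)) τ)))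
                 (cong (G b (c <ᵇ i) *_) (starting-with n (not b) c)))))

    ∑-weight : ∀ n b → ∑ₗ (perms (suc n)) (weight w b) ≡ T G n b
    ∑-weight n b = trans (first-letter n (weight w b)) (∑-cong (suc n) (λ i _ → starting-with n b i))

  -- R G n b i is a polynomial in i of degree n; coeff G n b j is its
  -- coefficient on the binomial basis C(i, j)
  jump : PairWeight → Bool → ℤ
  jump G b = G b true - G b false

  coeff : PairWeight → ℕ → Bool → ℕ → ℤ
  coeff G zero    b zero    = 1ℤ
  coeff G zero    b (suc j) = 0ℤ
  coeff G (suc n) b zero    = G b false * T G n (not b)
  coeff G (suc n) b (suc j) = jump G b * coeff G n (not b) j

  alternate : Bool → ℕ → Bool
  alternate b zero    = b
  alternate b (suc j) = alternate (not b) j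

  alternate-even : ∀ b q → alternate b (double q) ≡ b
  alternate-even true  zero    = refl
  alternate-even false zero    = refl
  alternate-even true  (suc q) = alternate-even true q
  alternate-even false (suc q) = alternate-even false q

  module _ (G : PairWeight) where

    split-weight : ∀ b (x : Bool) (r : ℤ) → G b x * r ≡ G b false * r + jump G b * (if x then r else 0ℤ)
    split-weight b true  r = sym (lemma (G b true) (G b false) r)
      where
      lemma : ∀ t f r → f * r + (t - f) * r ≡ t * r
      lemma = solve-∀
    split-weight b false r = sym (trans (cong (G b false * r +_) (ℤP.*-zeroʳ (jump G b))) (ℤP.+-identityʳ _))

    R-binomial : ∀ n b i → i ≤ n → R G n b i ≡ ∑ (suc n) (λ j → coeff G n b j * binom i j)
    R-binomial zero    b zero _   = refl
    R-binomial (suc n) b i    i≤ = begin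
        ∑ (suc n) (λ c → G b (c <ᵇ i) * R′ c)
      ≡⟨ ∑-cong (suc n) (λ c _ → split-weight b (c <ᵇ i) (R′ c)) ⟩
        ∑ (suc n) (λ c → G b false * R′ c + jump G b * below c)
      ≡⟨ ∑-+ (suc n) (λ c → G b false * R′ c) (λ c → jump G b * below c) ⟩
        ∑ (suc n) (λ c → G b false * R′ c) + ∑ (suc n) (λ c → jump G b * below c)
      ≡⟨ cong₂ _+_ (∑-* (suc n) (G b false) R′)
                   (trans (∑-* (suc n) (jump G b) below) (cong (jump G b *_) (∑-truncate (suc n) i R′ i≤))) ⟩
        G b false * T G n (not b) + jump G b * ∑ i R′
      ≡⟨ cong (λ t → G b false * T G n (not b) + jump G b * t)
              (∑-binomial-basis i (suc n) (coeff G n (not b)) R′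
                 (λ c c<i → R-binomial n (not b) c (ℕP.≤-pred (ℕP.≤-trans c<i i≤)))) ⟩
        G b false * T G n (not b) + jump G b * ∑ (suc n) (λ j → coeff G n (not b) j * binom i (suc j))
      ≡⟨ cong₂ _+_ (sym (ℤP.*-identityʳ (G b false * T G n (not b))))
                   (trans (sym (∑-* (suc n) (jump G b) (λ j → coeff G n (not b) j * binom i (suc j))))
                          (∑-cong (suc n) (λ j _ → sym (ℤP.*-assoc (jump G b) (coeff G n (not b) j) (binom i (suc j)))))) ⟩
        ∑ (suc (suc n)) (λ j → coeff G (suc n) b j * binom i j)
      ∎
      where
      open ≡-Reasoning
      R′ = R G n (not b)
      below : Seq
      below c = if c <ᵇ i then R′ c else 0ℤ

    T-binomial : ∀ n b → T G n b ≡ ∑ (suc n) (λ j → coeff G n b j * binom (suc n) (suc j))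
    T-binomial n b = ∑-binomial-basis (suc n) (suc n) (coeff G n b) (R G n b)
                                      (λ i i≤n → R-binomial n b i (ℕP.≤-pred i≤n))

    leading : Bool → ℕ → ℤ
    leading b zero    = 1ℤ
    leading b (suc j) = jump G b * leading (not b) j

    coeff-below : ∀ j n b → j < n →
      coeff G n b j ≡ leading b j * (G (alternate b j) false * T G (n ∸ suc j) (alternate b (suc j)))
    coeff-below zero    (suc n) b _         = sym (ℤP.*-identityˡ _)
    coeff-below (suc j) (suc n) b (s≤s j<n) =
      trans (cong (jump G b *_) (coeff-below j n (not b) j<n)) (sym (ℤP.*-assoc (jump G b) (leading (not b) j) _))

    coeff-top : ∀ n b → coeff G n b n ≡ leading b n
    coeff-top zero    b = refl
    coeff-top (suc n) b = cong (jump G b *_) (coeff-top n (not b))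

  -- For pair weights with G true true = 1, G true false = 0 (odd positions are
  -- forced to be descents, unweighted), G false false = α, G false true = μ + α,
  -- the totals s (n + 1) = T G n true (with s 0 = 1) satisfy the exponential
  -- generating function identity  K s = K + ∫ Σ μ^⌊n/2⌋ tⁿ/n!  for the even series
  -- K = 1 - α Σ μ^q t^(2q+2)/(2q+2)!.  Proof: expand T in the binomial basis;
  -- every coefficient below the top one cancels against a term of K s.
  module GeneratingFunction
    (α μ : ℤ) (G : PairWeight)
    (odd-descent : G true true ≡ 1ℤ) (odd-ascent : G true false ≡ 0ℤ)
    (even-ascent : G false false ≡ α) (even-descent : G false true ≡ μ + α)
    (K : Seq) (K-zero : K 0 ≡ 1ℤ) (K-odd : Even K) (K-even : ∀ q → K (double (suc q)) ≡ ℤ.- (α * μ ^ q))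
    where

    s : Seq
    s zero    = 1ℤ
    s (suc n) = T G n true

    leading-closed : ∀ n → leading G true n ≡ μ ^ ⌊ n /2⌋
    leading-closed zero          = refl
    leading-closed (suc zero)    = trans (cong₂ (λ t f → (t - f) * 1ℤ) odd-descent odd-ascent) refl
    leading-closed (suc (suc n)) =
      trans (cong₂ (λ u v → u * (v * leading G true n)) (cong₂ _-_ odd-descent odd-ascent) (cong₂ _-_ even-descent even-ascent))
            (trans (two-steps μ α (leading G true n)) (cong (μ *_) (leading-closed n)))
      where
      two-steps : ∀ μ α x → (1ℤ - 0ℤ) * (((μ + α) - α) * x) ≡ μ * x
      two-steps = solve-∀

    cancellation : ∀ n j → j < n → coeff G n true j + K (suc j) * s (n ∸ j) ≡ 0ℤ
    cancellation n j j<n rewrite ℕP.+-∸-assoc 1 j<n with parity j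
    ... | q , inj₁ refl = begin
        coeff G n true j + K (suc j) * T G r true
      ≡⟨ cong₂ _+_ (coeff-below G j n true j<n) (cong (_* T G r true) (K-odd q)) ⟩
        leading G true j * (G (alternate true j) false * T G r (alternate true (suc j))) + 0ℤ * T G r true
      ≡⟨ cong (λ b → leading G true j * (G b false * T G r (alternate true (suc j))) + 0ℤ * T G r true)
              (alternate-even true q) ⟩
        leading G true j * (G true false * T G r (alternate true (suc j))) + 0ℤ * T G r true
      ≡⟨ cong (λ g → leading G true j * (g * T G r (alternate true (suc j))) + 0ℤ * T G r true) odd-ascent ⟩
        leading G true j * (0ℤ * T G r (alternate true (suc j))) + 0ℤ * T G r true
      ≡⟨ vanish (leading G true j) (T G r (alternate true (suc j))) (T G r true) ⟩
        0ℤ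
      ∎
      where
      open ≡-Reasoning
      r = n ∸ suc j
      vanish : ∀ x y z → x * (0ℤ * y) + 0ℤ * z ≡ 0ℤ
      vanish = solve-∀
    ... | q , inj₂ refl = begin
        coeff G n true j + K (suc j) * T G r true
      ≡⟨ cong₂ _+_ (coeff-below G j n true j<n) (cong (_* T G r true) (K-even q)) ⟩
        leading G true j * (G (alternate true j) false * T G r (alternate true (suc j))) + ℤ.- (α * μ ^ q) * T G r true
      ≡⟨ cong₂ (λ b c → leading G true j * (G b false * T G r c) + ℤ.- (α * μ ^ q) * T G r true)
               (alternate-even false q) (alternate-even true q) ⟩
        leading G true j * (G false false * T G r true) + ℤ.- (α * μ ^ q) * T G r true
      ≡⟨ cong₂ (λ l g → l * (g * T G r true) + ℤ.- (α * μ ^ q) * T G r true)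
               (trans (leading-closed j) (cong (μ ^_) (⌊odd/2⌋ q))) even-ascent ⟩
        μ ^ q * (α * T G r true) + ℤ.- (α * μ ^ q) * T G r true
      ≡⟨ vanish (μ ^ q) α (T G r true) ⟩
        0ℤ
      ∎
      where
      open ≡-Reasoning
      r = n ∸ suc j
      vanish : ∀ x a t → x * (a * t) + ℤ.- (a * x) * t ≡ 0ℤ
      vanish = solve-∀

    Ks-identity : ∀ n → (K ⊛ s) (suc n) ≡ μ ^ ⌊ n /2⌋ + K (suc n)
    Ks-identity n = begin
        (K ⊛ s) (suc n)
      ≡⟨ ⊛-binomial K s (suc n) ⟩
        1ℤ * (K 0 * T G n true) + ∑ (suc n) (λ j → binom (suc n) (suc j) * (K (suc j) * s (n ∸ j)))
      ≡⟨ cong (_+ ∑ (suc n) (λ j → binom (suc n) (suc j) * (K (suc j) * s (n ∸ j))))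
              (trans (ℤP.*-identityˡ _) (trans (cong (_* T G n true) K-zero)
                     (trans (ℤP.*-identityˡ _) (T-binomial G n true)))) ⟩
        ∑ (suc n) (λ j → coeff G n true j * binom (suc n) (suc j)) + ∑ (suc n) (λ j → binom (suc n) (suc j) * (K (suc j) * s (n ∸ j)))
      ≡⟨ sym (∑-+ (suc n) (λ j → coeff G n true j * binom (suc n) (suc j))
                          (λ j → binom (suc n) (suc j) * (K (suc j) * s (n ∸ j)))) ⟩
        ∑ (suc n) (λ j → coeff G n true j * binom (suc n) (suc j) + binom (suc n) (suc j) * (K (suc j) * s (n ∸ j)))
      ≡⟨ ∑-cong (suc n) (λ j _ → factor (coeff G n true j) (binom (suc n) (suc j)) (K (suc j) * s (n ∸ j))) ⟩
        ∑ (suc n) term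
      ≡⟨ ∑-last n term ⟩
        ∑ n term + term n
      ≡⟨ cong₂ _+_ (trans (∑-cong n (λ j j<n → trans (cong (binom (suc n) (suc j) *_) (cancellation n j j<n))
                                                      (ℤP.*-zeroʳ (binom (suc n) (suc j)))))
                          (∑-zero n))
                   top-term ⟩
        0ℤ + (μ ^ ⌊ n /2⌋ + K (suc n))
      ≡⟨ ℤP.+-identityˡ _ ⟩
        μ ^ ⌊ n /2⌋ + K (suc n)
      ∎
      where
      open ≡-Reasoning
      term : Seq
      term j = binom (suc n) (suc j) * (coeff G n true j + K (suc j) * s (n ∸ j))
      factor : ∀ c z w → c * z + z * w ≡ z * (c + w)
      factor = solve-∀
      top-term : term n ≡ μ ^ ⌊ n /2⌋ + K (suc n)
      top-term = begin
          binom (suc n) (suc n) * (coeff G n true n + K (suc n) * s (n ∸ n))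
        ≡⟨ cong₂ (λ c k → c * (coeff G n true n + K (suc n) * s k)) (binom-diag (suc n)) (ℕP.n∸n≡0 n) ⟩
          1ℤ * (coeff G n true n + K (suc n) * 1ℤ)
        ≡⟨ ℤP.*-identityˡ _ ⟩
          coeff G n true n + K (suc n) * 1ℤ
        ≡⟨ cong₂ _+_ (trans (coeff-top G n true) (leading-closed n)) (ℤP.*-identityʳ (K (suc n))) ⟩
          μ ^ ⌊ n /2⌋ + K (suc n)
        ∎

  -- Complementation x ↦ n + 2 - x exchanges descents and ascents, so flipping
  -- the descent flag of the pair weight does not change the totals.
  flip : PairWeight → PairWeight
  flip G b d = G b (not d)

  complement-rank : ∀ n c i → c ≤ n → i ≤ suc n → ((n ∸ c) <ᵇ (suc n ∸ i)) ≡ not (c <ᵇ i)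
  complement-rank n       c       zero    c≤n _   = <ᵇ-true (s≤s (ℕP.m∸n≤m n c))
  complement-rank n       zero    (suc i) _   _   = <ᵇ-false (ℕP.m∸n≤m n i)
  complement-rank (suc n) (suc c) (suc i) (s≤s c≤n) (s≤s i≤n) = complement-rank n c i c≤n i≤n

  R-complement : ∀ G n b i → i ≤ n → R G n b (n ∸ i) ≡ R (flip G) n b i
  R-complement G zero    b i _   = refl
  R-complement G (suc n) b i i≤ = begin
      ∑ (suc n) (λ c → G b (c <ᵇ (suc n ∸ i)) * R G n (not b) c)
    ≡⟨ ∑-reverse n (λ c → G b (c <ᵇ (suc n ∸ i)) * R G n (not b) c) ⟩
      ∑ (suc n) (λ c → G b ((n ∸ c) <ᵇ (suc n ∸ i)) * R G n (not b) (n ∸ c))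
    ≡⟨ ∑-cong (suc n) (λ c c≤n → cong₂ (λ u v → G b u * v) (complement-rank n c i (ℕP.≤-pred c≤n) i≤)
                                                          (R-complement G n (not b) c (ℕP.≤-pred c≤n))) ⟩
      ∑ (suc n) (λ c → flip G b (c <ᵇ i) * R (flip G) n (not b) c)
    ∎ where open ≡-Reasoning

  T-complement : ∀ G n b → T G n b ≡ T (flip G) n b
  T-complement G n b = trans (∑-reverse n (R G n b))
                             (∑-cong (suc n) (λ i i≤n → R-complement G n b i (ℕP.≤-pred i≤n)))


module Instances where
  open import Defs
  open import Data.Nat as ℕ using (ℕ; zero; suc; _<ᵇ_; ⌊_/2⌋)
  open import Data.Bool as B using (true; false; not)
  open import Data.List using (List; []; _∷_; map; filter; length)
  open import Data.Integer as ℤ using (ℤ; _+_; _*_; _^_; 0ℤ; 1ℤ; -1ℤ)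
  import Data.Integer.Properties as ℤP
  open import Data.Integer.Tactic.RingSolver using (solve-∀)
  open import Data.Product using (_,_)
  open import Data.Sum using (inj₁; inj₂)
  open import Level using (0ℓ)
  open import Relation.Nullary.Decidable using (does; ¬?)
  open import Relation.Unary using (Pred; Decidable)
  open import Relation.Binary.PropositionalEquality
  open Parity
  open Series
  open Trig
  open Comparison using (Kᴬ; Kᴬ-odd; Kᴬ-even; Pᴬ; odd-coefficients; even-coefficients)
  open Permutations using (⟦_⟧; ∑ₗ; ∑ₗ-cong)
  open Transfer

  sumℤ-map : ∀ {A : Set} (xs : List A) (f : A → ℤ) → sumℤ (map f xs) ≡ ∑ₗ xs f
  sumℤ-map []       f = refl
  sumℤ-map (x ∷ xs) f = cong (f x +_) (sumℤ-map xs f)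

  count-as-sum : ∀ {A : Set} {P : Pred A 0ℓ} (P? : Decidable P) (xs : List A) →
                 ℤ.+ length (filter P? xs) ≡ ∑ₗ xs (λ x → ⟦ does (P? x) ⟧)
  count-as-sum P? []       = refl
  count-as-sum P? (x ∷ xs) with does (P? x)
  ... | true  = cong (1ℤ +_) (count-as-sum P? xs)
  ... | false = trans (count-as-sum P? xs) (sym (ℤP.+-identityˡ _))

  isEven-suc : ∀ i → isEven (suc i) ≡ not (isEven i)
  isEven-suc zero          = refl
  isEven-suc (suc zero)    = refl
  isEven-suc (suc (suc i)) = isEven-suc i

  -- the factor p^[odd descent] q^[even descent] at p = 0, q = -1
  wᴬ : LocalWeight
  wᴬ true  true  _ = 0ℤ
  wᴬ true  false _ = 1ℤ
  wᴬ false true  _ = -1ℤ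
  wᴬ false false _ = 1ℤ

  -- alternating: descents at odd positions, ascents at even positions
  wᴱ : LocalWeight
  wᴱ true  d _ = ⟦ d ⟧
  wᴱ false _ u = ⟦ u ⟧

  oddCount evenCount : List ℕ → ℕ
  oddCount  D = length (filter (λ i → ¬? (isEven i B.≟ true)) D)
  evenCount D = length (filter (λ i → isEven i B.≟ true) D)

  descent-step : ∀ i D u → (ℤ.+ 0) ^ oddCount (i ∷ D) * -1ℤ ^ evenCount (i ∷ D)
                           ≡ wᴬ (not (isEven i)) true u * ((ℤ.+ 0) ^ oddCount D * -1ℤ ^ evenCount D)
  descent-step i D u with isEven i
  ... | false = refl
  ... | true  = sign-out ((ℤ.+ 0) ^ oddCount D) (-1ℤ ^ evenCount D)
    where
    sign-out : ∀ z s → z * (-1ℤ * s) ≡ -1ℤ * (z * s)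
    sign-out = solve-∀

  ascent-step : ∀ b u r → wᴬ b false u * r ≡ r
  ascent-step true  u r = ℤP.*-identityˡ r
  ascent-step false u r = ℤP.*-identityˡ r

  local-A : ∀ i π → (ℤ.+ 0) ^ oddCount (descentsFrom i π) * -1ℤ ^ evenCount (descentsFrom i π)
                    ≡ weight wᴬ (not (isEven i)) π
  local-A i []          = refl
  local-A i (x ∷ [])    = refl
  local-A i (x ∷ y ∷ v) with trans (local-A (suc i) (y ∷ v)) (cong (λ b → weight wᴬ (not b) (y ∷ v)) (isEven-suc i))
  ... | IH with y <ᵇ x
  ... | false = trans IH (sym (ascent-step (not (isEven i)) (x <ᵇ y) _))
  ... | true  = trans (descent-step i (descentsFrom (suc i) (y ∷ v)) (x <ᵇ y))
                      (cong (wᴬ (not (isEven i)) true (x <ᵇ y) *_) IH)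

  local-E : ∀ i π → ⟦ altFrom i π ⟧ ≡ weight wᴱ (not (isEven i)) π
  local-E i []          = refl
  local-E i (x ∷ [])    = refl
  local-E i (x ∷ y ∷ v) with trans (local-E (suc i) (y ∷ v)) (cong (λ b → weight wᴱ (not b) (y ∷ v)) (isEven-suc i))
  ... | IH with isEven i
  ... | true  = trans (Permutations.⟦∧⟧ (x <ᵇ y) (altFrom (suc i) (y ∷ v))) (cong (⟦ x <ᵇ y ⟧ *_) IH)
  ... | false = trans (Permutations.⟦∧⟧ (y <ᵇ x) (altFrom (suc i) (y ∷ v))) (cong (⟦ y <ᵇ x ⟧ *_) IH)

  A-total : ∀ n → A (suc n) (ℤ.+ 0) -1ℤ ≡ T (flip (pairWeight wᴬ)) n true
  A-total n = trans (sumℤ-map (perms (suc n)) _)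
    (trans (∑ₗ-cong (perms (suc n)) (local-A 1))
     (trans (∑-weight wᴬ n true) (T-complement (pairWeight wᴬ) n true)))

  E-total : ∀ n → ℤ.+ E (suc n) ≡ T (pairWeight wᴱ) n true
  E-total n = trans (count-as-sum _ (perms (suc n)))
    (trans (∑ₗ-cong (perms (suc n)) (λ π → trans (cong ⟦_⟧ (decides (alternating π))) (local-E 1 π)))
     (∑-weight wᴱ n true))
    where
    decides : ∀ b → does (b B.≟ true) ≡ b
    decides true  = refl
    decides false = refl

  Gᴬ Gᴱ : PairWeight
  Gᴬ = flip (pairWeight wᴬ)
  Gᴱ = pairWeight wᴱ

  private
    neg-neg : ∀ x → x ≡ ℤ.- (-1ℤ * x)
    neg-neg = solve-∀
    neg-one : ∀ x → -1ℤ * x ≡ ℤ.- (1ℤ * x)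
    neg-one = solve-∀

  module Aˢ = GeneratingFunction -1ℤ (ℤ.+ 2) Gᴬ refl refl refl refl Kᴬ refl Kᴬ-odd
                (λ q → trans (Kᴬ-even q) (neg-neg _))
  module Eˢ = GeneratingFunction 1ℤ -1ℤ Gᴱ refl refl refl refl cosᶜ refl cos-odd
                (λ q → trans (cong (-1ℤ *_) (cos-even q)) (neg-one _))

  -- Kᴬ a = Pᴬ, i.e.  a = (cosh (√2 t) + sinh (√2 t)/√2) / cosh² (t/√2)
  a-eq : Kᴬ ⊛ Aˢ.s ≗ Pᴬ
  a-eq zero    = refl
  a-eq (suc n) = trans (Aˢ.Ks-identity n) (by-parity n)
    where
    by-parity : ∀ n → (ℤ.+ 2) ^ ⌊ n /2⌋ + Kᴬ (suc n) ≡ Pᴬ (suc n)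
    by-parity n with parity n
    ... | q , inj₁ refl rewrite Kᴬ-odd q | ⌊double/2⌋ q | ⌊odd/2⌋ q = ℤP.+-identityʳ _
    ... | q , inj₂ refl rewrite Kᴬ-even q | ⌊odd/2⌋ q | ⌊double/2⌋ q = twice ((ℤ.+ 2) ^ q)
      where
      twice : ∀ x → x + x ≡ ℤ.+ 2 * x
      twice = solve-∀

  -- cos e = sin + 1, i.e.  e = sec t + tan t
  e-eq : cosᶜ ⊛ Eˢ.s ≗ sinᶜ ⊕ one
  e-eq zero    = refl
  e-eq (suc n) = trans (Eˢ.Ks-identity n) (by-parity n)
    where
    by-parity : ∀ n → -1ℤ ^ ⌊ n /2⌋ + cosᶜ (suc n) ≡ sinᶜ (suc n) + 0ℤ
    by-parity n with parity n
    ... | q , inj₁ refl rewrite cos-odd q | sin-odd q | ⌊double/2⌋ q = refl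
    ... | q , inj₂ refl rewrite cos-even (suc q) | sin-even (suc q) | ⌊odd/2⌋ q = cancel (-1ℤ ^ q)
      where
      cancel : ∀ x → x + -1ℤ * x ≡ 0ℤ + 0ℤ
      cancel = solve-∀

  A-odd : ∀ m → (ℤ.+ 2) ^ m * A (suc (double m)) (ℤ.+ 0) -1ℤ ≡ -1ℤ ^ m * ℤ.+ E (suc (double m))
  A-odd m = begin
      (ℤ.+ 2) ^ m * A (suc (double m)) (ℤ.+ 0) -1ℤ   ≡⟨ cong ((ℤ.+ 2) ^ m *_) (A-total (double m)) ⟩
      (ℤ.+ 2) ^ m * Aˢ.s (suc (double m))             ≡⟨ odd-coefficients Aˢ.s Eˢ.s a-eq e-eq m ⟩
      -1ℤ ^ m * Eˢ.s (suc (double m))                 ≡⟨ cong (-1ℤ ^ m *_) (sym (E-total (double m))) ⟩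
      -1ℤ ^ m * ℤ.+ E (suc (double m))                ∎
    where open ≡-Reasoning

  A-even : ∀ m → (ℤ.+ 2) ^ suc m * A (double (suc m)) (ℤ.+ 0) -1ℤ ≡ -1ℤ ^ m * ℤ.+ E (suc (double (suc m)))
  A-even m = begin
      (ℤ.+ 2) ^ suc m * A (double (suc m)) (ℤ.+ 0) -1ℤ   ≡⟨ cong ((ℤ.+ 2) ^ suc m *_) (A-total (suc (double m))) ⟩
      (ℤ.+ 2) ^ suc m * Aˢ.s (double (suc m))             ≡⟨ even-coefficients Aˢ.s Eˢ.s a-eq e-eq m ⟩
      -1ℤ ^ m * Eˢ.s (suc (double (suc m)))               ≡⟨ cong (-1ℤ ^ m *_) (sym (E-total (double (suc m)))) ⟩
      -1ℤ ^ m * ℤ.+ E (suc (double (suc m)))              ∎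
    where open ≡-Reasoning


module Conversions where
  open import Data.Nat as ℕ using (ℕ; zero; suc; _^_)
  import Data.Nat.Properties as ℕP
  open import Data.Nat.Properties using (m^n≢0)
  open import Data.Integer as ℤ using (ℤ; +_)
  import Data.Integer.Properties as ℤP
  open import Data.Rational using (_/_)
  import Data.Rational.Properties as ℚP
  import Data.Rational.Unnormalised as ℚᵘ
  open import Relation.Binary.PropositionalEquality
  open Parity

  scaled-fraction : ∀ (x y : ℤ) (k : ℕ) .{{_ : ℕ.NonZero k}} → + k ℤ.* x ≡ y → x / 1 ≡ y / k
  scaled-fraction x y (suc d) e = ℚP.fromℚᵘ-cong {ℚᵘ.mkℚᵘ x 0} {ℚᵘ.mkℚᵘ y d}
    (ℚᵘ.*≡* (trans (ℤP.*-comm x (+ suc d)) (trans e (sym (ℤP.*-identityʳ y)))))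

  +-^ : ∀ m n → + (m ^ n) ≡ (+ m) ℤ.^ n
  +-^ m zero    = refl
  +-^ m (suc n) = trans (ℤP.pos-* m (m ^ n)) (cong (+ m ℤ.*_) (+-^ m n))

  power-of-two-fraction : ∀ {x y : ℤ} k → (+ 2) ℤ.^ k ℤ.* x ≡ y → x / 1 ≡ _/_ y (2 ^ k) {{m^n≢0 2 k}}
  power-of-two-fraction {x} {y} k eq =
    scaled-fraction x y (2 ^ k) {{m^n≢0 2 k}} (trans (cong (ℤ._* x) (+-^ 2 k)) eq)

  odd-index : ∀ m → 2 ℕ.* m ℕ.+ 1 ≡ suc (double m)
  odd-index m = trans (ℕP.+-comm (2 ℕ.* m) 1) (cong suc (double≡2* m))

  even-index : ∀ m → 2 ℕ.* m ℕ.+ 2 ≡ double (suc m)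
  even-index m = trans (ℕP.+-comm (2 ℕ.* m) 2) (cong (λ k → suc (suc k)) (double≡2* m))

  odd-index′ : ∀ m → 2 ℕ.* m ℕ.+ 3 ≡ suc (double (suc m))
  odd-index′ m = trans (ℕP.+-comm (2 ℕ.* m) 3) (cong (λ k → suc (suc (suc k))) (double≡2* m))


open import Defs
open import Data.Nat using (ℕ; suc; _+_; _*_; _^_)
open import Data.Nat.Properties using (m^n≢0)
open import Data.Integer using (ℤ; +_; -1ℤ)
import Data.Integer as ℤ
open import Data.Rational using (ℚ; _/_)
open import Data.Product using (_×_)
open import Relation.Binary.PropositionalEquality using (_≡_)

open import Data.Product using (_,_)
open import Relation.Binary.PropositionalEquality using (sym; subst; subst₂)
open import Data.Nat.Properties using (+-comm)
open Conversions
open Instances using (A-odd; A-even)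
open Parity using (double)

lemma3p4 : (m : ℕ) →
    ((A (2 * m + 1) (+ 0) -1ℤ) / 1
    ≡ _/_ ((-1ℤ ℤ.^ m) ℤ.* (+ E (2 * m + 1))) (2 ^ m) {{m^n≢0 2 m}})
    × ((A (2 * m + 2) (+ 0) -1ℤ) / 1
    ≡ _/_ ((-1ℤ ℤ.^ m) ℤ.* (+ E (2 * m + 3))) (2 ^ (m + 1)) {{m^n≢0 2 (m + 1)}})
lemma3p4 m = odd-part , even-part
  where
  odd-part : (A (2 * m + 1) (+ 0) -1ℤ) / 1 ≡ _/_ ((-1ℤ ℤ.^ m) ℤ.* (+ E (2 * m + 1))) (2 ^ m) {{m^n≢0 2 m}}
  odd-part = subst (λ n → A n (+ 0) -1ℤ / 1 ≡ _/_ (-1ℤ ℤ.^ m ℤ.* + E n) (2 ^ m) {{m^n≢0 2 m}})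
                   (sym (odd-index m)) (power-of-two-fraction m (A-odd m))
  even-part : (A (2 * m + 2) (+ 0) -1ℤ) / 1 ≡ _/_ ((-1ℤ ℤ.^ m) ℤ.* (+ E (2 * m + 3))) (2 ^ (m + 1)) {{m^n≢0 2 (m + 1)}}
  even-part = subst₂ (λ n k → A n (+ 0) -1ℤ / 1 ≡ _/_ (-1ℤ ℤ.^ m ℤ.* + E k) (2 ^ (m + 1)) {{m^n≢0 2 (m + 1)}})
                     (sym (even-index m)) (sym (odd-index′ m))
                     (subst (λ j → A (double (suc m)) (+ 0) -1ℤ / 1
                                   ≡ _/_ (-1ℤ ℤ.^ m ℤ.* + E (suc (double (suc m)))) (2 ^ j) {{m^n≢0 2 j}})
                            (+-comm 1 m)
                            (power-of-two-fraction (suc m) (A-even m)))
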